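{- Let $G$ be a graph of order $n$ with stability number $\alpha$ (so $1\le \alpha\le n$). Then \[ F(G)\le f_{\sf T}(n,\alpha)=\left(\left\lceil\tfrac{n}{\alpha}\right\rceil+1\right)^{p}\left(\left\lfloor\tfrac{n}{\alpha}\right\rfloor+1\right)^{\alpha-p},\qquad p=n \bmod \alpha, \] with equality if and only if $G\simeq T_{n,\alpha}$.
   Context: All graphs are finite, simple and undirected. The Fibonacci index $F(G)$ of a graph $G$ is the number of stable (independent) sets of $G$, including the empty set. The stability number $\alpha(G)$ is the maximum size of a stable set. For integers $1\le\alpha\le n$, the Turán graph $T_{n,\alpha}$ is the disjoint union of $\alpha$ cliques whose orders sum to $n$ and differ pairwise by at most one (so each has $\lceil n/\alpha\rceil$ or $\lfloor n/\alpha\rfloor$ vertices); $f_{\sf T}(n,\alpha)$ denotes $F(T_{n,\alpha})$. -}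

module Defs where

open import Data.Bool using (Bool; true; false; _∧_; not; if_then_else_)
open import Data.Nat using (ℕ; zero; suc; _+_; _*_; _∸_; _^_; _⊔_; NonZero; _/_; _%_)
open import Data.Fin using (Fin; toℕ)
open import Data.Fin.Properties using (_≟_)
open import Data.Vec using (Vec; []; _∷_; lookup)
open import Data.List using (List; []; _∷_; map; _++_; length; filter; foldr; allFin)
open import Data.Bool.ListAction using (all)
open import Relation.Binary.PropositionalEquality using (_≡_)
open import Relation.Nullary using (¬_)
open import Relation.Nullary.Decidable using (⌊_⌋)
open import Data.Fin.Permutation using (Permutation′; _⟨$⟩ʳ_)
open import Data.Product using (Σ)
import Data.Nat.Properties as ℕP

record Graph (n : ℕ) : Set where
  field
    adj    : Fin n → Fin n → Bool
    adj-sym    : ∀ i j → adj i j ≡ adj j i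
    adj-irrefl : ∀ i → adj i i ≡ false
open Graph public

subsets : (n : ℕ) → List (Vec Bool n)
subsets zero = [] ∷ []
subsets (suc n) = map (false ∷_) (subsets n) ++ map (true ∷_) (subsets n)

card : ∀ {n} → Vec Bool n → ℕ
card [] = 0
card (true ∷ s) = suc (card s)
card (false ∷ s) = card s

isStable : ∀ {n} → Graph n → Vec Bool n → Bool
isStable {n} G s =
  all (λ i → all (λ j → not (lookup s i ∧ lookup s j ∧ adj G i j)) (allFin n)) (allFin n)

stableSets : ∀ {n} → Graph n → List (Vec Bool n)
stableSets {n} G = filter (λ s → isStable G s ≡? true) (subsets n)
  where
  open import Data.Bool.Properties using () renaming (_≟_ to _≡?_)

-- Fibonacci index: number of stable sets (including the empty one)
fibIndex : ∀ {n} → Graph n → ℕ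
fibIndex G = length (stableSets G)

stabilityNumber : ∀ {n} → Graph n → ℕ
stabilityNumber G = foldr _⊔_ 0 (map card (stableSets G))

-- Turán graph T_{n,α}: vertex i lies in clique (i mod α); the α residue classes
-- of {0,…,n-1} have sizes ⌈n/α⌉ or ⌊n/α⌋.  Adjacent iff distinct and same class.
turanAdj : (n α : ℕ) .{{_ : NonZero α}} → Fin n → Fin n → Bool
turanAdj n α i j = not ⌊ i ≟ j ⌋ ∧ ⌊ toℕ i % α ℕP.≟ toℕ j % α ⌋

turan : (n α : ℕ) .{{_ : NonZero α}} → Graph n
turan n α = record { adj = turanAdj n α ; adj-sym = symP ; adj-irrefl = irr }
  where
  open import Relation.Binary.PropositionalEquality using (refl; sym; cong₂)
  open import Relation.Nullary using (yes; no)
  open import Data.Bool.Properties using (∧-comm)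
  symP : ∀ i j → turanAdj n α i j ≡ turanAdj n α j i
  symP i j with i ≟ j | j ≟ i
  ... | yes _ | yes _ = refl
  ... | yes p | no q = Data.Empty.⊥-elim (q (sym p)) where import Data.Empty
  ... | no p | yes q = Data.Empty.⊥-elim (p (sym q)) where import Data.Empty
  ... | no _ | no _ with toℕ i % α ℕP.≟ toℕ j % α | toℕ j % α ℕP.≟ toℕ i % α
  ...   | yes _ | yes _ = refl
  ...   | yes p | no q = Data.Empty.⊥-elim (q (sym p)) where import Data.Empty
  ...   | no p | yes q = Data.Empty.⊥-elim (p (sym q)) where import Data.Empty
  ...   | no _ | no _ = refl
  irr : ∀ i → turanAdj n α i i ≡ false
  irr i with i ≟ i
  ... | yes _ = refl
  ... | no p = Data.Empty.⊥-elim (p refl) where import Data.Empty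

fT : (n α : ℕ) .{{_ : NonZero α}} → ℕ
fT n α = fibIndex (turan n α)

ceilDiv : (n α : ℕ) .{{_ : NonZero α}} → ℕ
ceilDiv n α = (n + (α ∸ 1)) / α

_≃G_ : ∀ {n} → Graph n → Graph n → Set
_≃G_ {n} G H = Σ (Permutation′ n) λ π → ∀ i j → adj G i j ≡ adj H (π ⟨$⟩ʳ i) (π ⟨$⟩ʳ j)

module Submission where

open import Defs
open import Data.Nat using (ℕ; _≤_; _+_; _*_; _∸_; _^_; _/_; _%_; NonZero)
open import Data.Product using (_×_)
open import Relation.Binary.PropositionalEquality using (_≡_)
open import Function.Bundles using (_⇔_)

-- Vertex sets are Boolean predicates A on Fin n and #stable A counts the stable
-- sets inside A, so F(G) = #stable (all vertices).  For v ∈ A the deletion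
-- recurrence #stable A = #stable (A ∖ v) + #stable (A ∖ N[v]) holds.  The
-- Turán value turanF m a = (q+2)^p (q+1)^(a−p), q = m / a, p = m mod a, obeys
--   turanF (m+1) (a+1) = turanF m (a+1) + turanF (m − m/(a+1)) a
-- and increases with m.  If stable sets in A have at most a+1 elements, a
-- greedy argument gives deg v ≥ |A ∖ v| / (a+1) for a vertex v of maximum
-- degree; induction on |A| then yields #stable A ≤ turanF |A| a (upperBound).
-- In the equality case both recursive estimates are tight, so deg v is exactly
-- |A ∖ v| / (a+1), and by induction A ∖ v and A ∖ N[v] are unions of cliques
-- with Turán class sizes; N(v) is then one of these cliques and A is again of
-- this shape (extremal).  A union of cliques has ∏ (size + 1) stable sets,
-- which evaluates F(T_{n,α}); and a labelling with Turán class sizes yields an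
-- explicit isomorphism with turan n α (TuranShaped-≃).

open import Data.Bool using (Bool; true; false; _∧_; _∨_; not; T; if_then_else_)
import Data.Bool.Properties as BoolP
open import Data.Nat using (zero; suc; _<_; z≤n; s≤s; s≤s⁻¹; _≡ᵇ_; _<ᵇ_; _⊔_)
open import Data.Nat.Properties hiding (_≟_)
import Data.Nat.Properties as ℕP
open import Data.Nat.DivMod
open import Data.Nat.Tactic.RingSolver using (solve-∀)
open import Data.Fin using (Fin; zero; suc; toℕ; fromℕ<; punchOut)
open import Data.Fin.Properties
  using (_≟_; toℕ-fromℕ<; toℕ-injective; punchOut-injective; injective⇒≤)
open import Data.Fin.Permutation using (Permutation′; _⟨$⟩ʳ_; _⟨$⟩ˡ_; inverseˡ; permutation)
import Data.Fin.Permutation as Permutation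
open import Data.Vec using (Vec; []; _∷_; lookup; _[_]≔_; replicate)
open import Data.Vec.Properties using (lookup∘update; lookup∘update′; lookup-replicate)
open import Data.List using (List; []; _∷_; map; _++_; length; filter; foldr; allFin; tabulate)
open import Data.Bool.ListAction using (all)
open import Data.List.Membership.Propositional using (_∈_)
open import Data.List.Relation.Unary.Any using (here; there)
open import Data.List.Membership.Propositional.Properties using (∈-++⁺ˡ; ∈-++⁺ʳ; ∈-map⁺)
open import Data.Product using (Σ; _,_; proj₁; proj₂)
open import Data.Sum using (_⊎_; inj₁; inj₂)
open import Data.Empty using (⊥; ⊥-elim)
open import Relation.Binary.PropositionalEquality
  using (_≢_; refl; sym; trans; cong; cong₂; subst; subst₂; module ≡-Reasoning)
open import Relation.Binary.Definitions using (tri<; tri≈; tri>)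
open import Relation.Nullary using (¬_; yes; no)
open import Relation.Nullary.Decidable using (isYes≗does)
open import Function using (_∘_)
open import Function.Bundles using (mk⇔)
import Algebra.Properties.CommutativeMonoid.Sum as MonoidSum

true-ext : ∀ {x y : Bool} → (x ≡ true → y ≡ true) → (y ≡ true → x ≡ true) → x ≡ y
true-ext {false} {false} _ _ = refl
true-ext {false} {true}  _ g with g refl
... | ()
true-ext {true}  {false} f _ with f refl
... | ()
true-ext {true}  {true}  _ _ = refl

∧-trueˡ : ∀ {x y} → x ∧ y ≡ true → x ≡ true
∧-trueˡ {true} _ = refl

∧-trueʳ : ∀ {x y} → x ∧ y ≡ true → y ≡ true
∧-trueʳ {true} e = e

∧-true : ∀ {x y} → x ≡ true → y ≡ true → x ∧ y ≡ true
∧-true refl refl = refl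

not-true : ∀ {x} → not x ≡ true → x ≡ false
not-true {false} _ = refl

not-false : ∀ {x} → x ≡ false → not x ≡ true
not-false refl = refl

false≢true : ∀ {x} → x ≡ false → x ≡ true → ⊥
false≢true refl ()

≡ᵇ-sound : ∀ {x y} → (x ≡ᵇ y) ≡ true → x ≡ y
≡ᵇ-sound {x} {y} e = ≡ᵇ⇒≡ x y (subst T (sym e) _)

≡ᵇ-complete : ∀ {x y} → x ≡ y → (x ≡ᵇ y) ≡ true
≡ᵇ-complete {zero} refl = refl
≡ᵇ-complete {suc x} refl = ≡ᵇ-complete {x} refl

≡ᵇ-false : ∀ {x y} → x ≢ y → (x ≡ᵇ y) ≡ false
≡ᵇ-false {x} {y} ne with x ≡ᵇ y in e
... | false = refl
... | true  = ⊥-elim (ne (≡ᵇ-sound e))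

<ᵇ-complete : ∀ {r p} → r < p → (r <ᵇ p) ≡ true
<ᵇ-complete {zero} {suc p} _ = refl
<ᵇ-complete {suc r} {suc (suc p)} (s≤s lt) = <ᵇ-complete lt

<ᵇ-false : ∀ {r p} → ¬ (r < p) → (r <ᵇ p) ≡ false
<ᵇ-false {r} {p} nl with r <ᵇ p in e
... | false = refl
... | true  = ⊥-elim (nl (<ᵇ⇒< r p (subst T (sym e) _)))

<ᵇ-irrefl : ∀ x → (x <ᵇ x) ≡ false
<ᵇ-irrefl x = <ᵇ-false {x} (<-irrefl refl)

_==_ : ∀ {n} → Fin n → Fin n → Bool
zero  == zero  = true
zero  == suc _ = false
suc _ == zero  = false
suc i == suc j = i == j

==-refl : ∀ {n} (i : Fin n) → (i == i) ≡ true
==-refl zero    = refl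
==-refl (suc i) = ==-refl i

==-sound : ∀ {n} {i j : Fin n} → (i == j) ≡ true → i ≡ j
==-sound {i = zero}  {zero}  _ = refl
==-sound {i = suc i} {suc j} e = cong suc (==-sound e)

==-false : ∀ {n} {i j : Fin n} → i ≢ j → (i == j) ≡ false
==-false {i = i} {j} ne with i == j in e
... | false = refl
... | true  = ⊥-elim (ne (==-sound e))

ind : Bool → ℕ
ind true  = 1
ind false = 0

ind-mono : ∀ {x y} → (x ≡ true → y ≡ true) → ind x ≤ ind y
ind-mono {false} _ = z≤n
ind-mono {true}  f rewrite f refl = s≤s z≤n

countL : ∀ {X : Set} → (X → Bool) → List X → ℕ
countL P []       = 0
countL P (x ∷ xs) = ind (P x) + countL P xs

countL-filter : ∀ {X : Set} (P : X → Bool) xs →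
  length (filter (λ x → P x BoolP.≟ true) xs) ≡ countL P xs
countL-filter P [] = refl
countL-filter P (x ∷ xs) with P x
... | true  = cong suc (countL-filter P xs)
... | false = countL-filter P xs

countL-ext : ∀ {X : Set} {P Q : X → Bool} → (∀ x → P x ≡ Q x) → ∀ xs → countL P xs ≡ countL Q xs
countL-ext e []       = refl
countL-ext e (x ∷ xs) = cong₂ _+_ (cong ind (e x)) (countL-ext e xs)

countL-++ : ∀ {X : Set} (P : X → Bool) xs ys → countL P (xs ++ ys) ≡ countL P xs + countL P ys
countL-++ P []       ys = refl
countL-++ P (x ∷ xs) ys =
  trans (cong (ind (P x) +_) (countL-++ P xs ys)) (sym (+-assoc (ind (P x)) _ _))

countL-map : ∀ {X Y : Set} (P : Y → Bool) (g : X → Y) xs → countL P (map g xs) ≡ countL (P ∘ g) xs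
countL-map P g []       = refl
countL-map P g (x ∷ xs) = cong (ind (P (g x)) +_) (countL-map P g xs)

countL-false : ∀ {X : Set} {P : X → Bool} → (∀ x → P x ≡ false) → ∀ xs → countL P xs ≡ 0
countL-false e []       = refl
countL-false e (x ∷ xs) rewrite e x = countL-false e xs

countL-split : ∀ {X : Set} (P Q : X → Bool) xs →
  countL P xs ≡ countL (λ x → P x ∧ Q x) xs + countL (λ x → P x ∧ not (Q x)) xs
countL-split P Q [] = refl
countL-split P Q (x ∷ xs) with P x | Q x
... | false | _     = countL-split P Q xs
... | true  | true  = cong suc (countL-split P Q xs)
... | true  | false = trans (cong suc (countL-split P Q xs)) (sym (+-suc _ _))

countSubsets : ∀ n → (Vec Bool n → Bool) → ℕ
countSubsets n P = countL P (subsets n)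

countSubsets-suc : ∀ n (P : Vec Bool (suc n) → Bool) →
  countSubsets (suc n) P ≡ countSubsets n (λ s → P (false ∷ s)) + countSubsets n (λ s → P (true ∷ s))
countSubsets-suc n P =
  trans (countL-++ P (map (false ∷_) (subsets n)) (map (true ∷_) (subsets n)))
        (cong₂ _+_ (countL-map P (false ∷_) (subsets n)) (countL-map P (true ∷_) (subsets n)))

countSubsets-ext : ∀ n {P Q : Vec Bool n → Bool} → (∀ s → P s ≡ Q s) → countSubsets n P ≡ countSubsets n Q
countSubsets-ext n e = countL-ext e (subsets n)

countSubsets-false : ∀ n {P : Vec Bool n → Bool} → (∀ s → P s ≡ false) → countSubsets n P ≡ 0
countSubsets-false n e = countL-false e (subsets n)

-- Adding v is a bijection from the subsets avoiding v onto those containing v.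
countSubsets-insert : ∀ n (v : Fin n) (P : Vec Bool n → Bool) →
  countSubsets n (λ s → lookup s v ∧ P s) ≡ countSubsets n (λ s → not (lookup s v) ∧ P (s [ v ]≔ true))
countSubsets-insert (suc n) zero P = begin
  countSubsets (suc n) (λ s → lookup s zero ∧ P s)
    ≡⟨ countSubsets-suc n (λ s → lookup s zero ∧ P s) ⟩
  countSubsets n (λ _ → false) + countSubsets n (λ s → P (true ∷ s))
    ≡⟨ cong (_+ countSubsets n (λ s → P (true ∷ s))) (countSubsets-false n (λ _ → refl)) ⟩
  countSubsets n (λ s → P (true ∷ s))
    ≡⟨ sym (+-identityʳ _) ⟩
  countSubsets n (λ s → P (true ∷ s)) + 0
    ≡⟨ cong (countSubsets n (λ s → P (true ∷ s)) +_) (sym (countSubsets-false n (λ _ → refl))) ⟩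
  countSubsets n (λ s → P (true ∷ s)) + countSubsets n (λ _ → false)
    ≡⟨ sym (countSubsets-suc n (λ s → not (lookup s zero) ∧ P (s [ zero ]≔ true))) ⟩
  countSubsets (suc n) (λ s → not (lookup s zero) ∧ P (s [ zero ]≔ true)) ∎
  where open ≡-Reasoning
countSubsets-insert (suc n) (suc v) P =
  trans (countSubsets-suc n (λ s → lookup s (suc v) ∧ P s))
  (trans (cong₂ _+_ (countSubsets-insert n v (λ s → P (false ∷ s)))
                    (countSubsets-insert n v (λ s → P (true ∷ s))))
         (sym (countSubsets-suc n (λ s → not (lookup s (suc v)) ∧ P (s [ suc v ]≔ true)))))

isEmpty : ∀ {n} → Vec Bool n → Bool
isEmpty []       = true
isEmpty (b ∷ s) = not b ∧ isEmpty s

countSubsets-isEmpty : ∀ n → countSubsets n isEmpty ≡ 1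
countSubsets-isEmpty zero    = refl
countSubsets-isEmpty (suc n) =
  trans (countSubsets-suc n isEmpty)
        (cong₂ _+_ (countSubsets-isEmpty n) (countSubsets-false n (λ _ → refl)))

isEmpty-sound : ∀ {n} (s : Vec Bool n) → isEmpty s ≡ true → ∀ i → lookup s i ≡ false
isEmpty-sound (b ∷ s) e zero    = not-true (∧-trueˡ e)
isEmpty-sound (b ∷ s) e (suc i) = isEmpty-sound s (∧-trueʳ {not b} e) i

isEmpty-complete : ∀ {n} (s : Vec Bool n) → (∀ i → lookup s i ≡ false) → isEmpty s ≡ true
isEmpty-complete []       _ = refl
isEmpty-complete (b ∷ s) h = ∧-true (not-false (h zero)) (isEmpty-complete s (h ∘ suc))

count : ∀ {n} → (Fin n → Bool) → ℕ
count {zero}  P = 0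
count {suc n} P = ind (P zero) + count (P ∘ suc)

count-ext : ∀ {n} {P Q : Fin n → Bool} → (∀ i → P i ≡ Q i) → count P ≡ count Q
count-ext {zero}  e = refl
count-ext {suc n} e = cong₂ _+_ (cong ind (e zero)) (count-ext (e ∘ suc))

count-mono : ∀ {n} {P Q : Fin n → Bool} → (∀ i → P i ≡ true → Q i ≡ true) → count P ≤ count Q
count-mono {zero}  h = z≤n
count-mono {suc n} h = +-mono-≤ (ind-mono (h zero)) (count-mono (h ∘ suc))

count-strict : ∀ {n} {P Q : Fin n → Bool} → (∀ i → P i ≡ true → Q i ≡ true) →
  (j : Fin n) → Q j ≡ true → P j ≡ false → count P < count Q
count-strict {suc n} h zero qj pj rewrite qj | pj = s≤s (count-mono (h ∘ suc))
count-strict {suc n} h (suc j) qj pj = +-mono-≤-< (ind-mono (h zero)) (count-strict (h ∘ suc) j qj pj)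

count-tight : ∀ {n} {P Q : Fin n → Bool} → (∀ i → P i ≡ true → Q i ≡ true) →
  count P ≡ count Q → ∀ j → Q j ≡ true → P j ≡ true
count-tight {P = P} h e j qj with P j in pj
... | true  = refl
... | false = ⊥-elim (<-irrefl e (count-strict h j qj pj))

count-split : ∀ {n} (P Q : Fin n → Bool) →
  count P ≡ count (λ i → P i ∧ Q i) + count (λ i → P i ∧ not (Q i))
count-split {zero} P Q = refl
count-split {suc n} P Q with P zero | Q zero
... | false | _     = count-split (P ∘ suc) (Q ∘ suc)
... | true  | true  = cong suc (count-split (P ∘ suc) (Q ∘ suc))
... | true  | false = trans (cong suc (count-split (P ∘ suc) (Q ∘ suc))) (sym (+-suc _ _))

count-zero : ∀ {n} {P : Fin n → Bool} → (∀ i → P i ≡ false) → count P ≡ 0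
count-zero {zero}  h = refl
count-zero {suc n} h rewrite h zero = count-zero (h ∘ suc)

count-all : ∀ n → count {n} (λ _ → true) ≡ n
count-all zero    = refl
count-all (suc n) = cong suc (count-all n)

find : ∀ {n} (P : Fin n → Bool) → (Σ (Fin n) λ i → P i ≡ true) ⊎ (∀ i → P i ≡ false)
find {zero} P = inj₂ λ ()
find {suc n} P with P zero in e
... | true = inj₁ (zero , e)
... | false with find (P ∘ suc)
...   | inj₁ (i , p) = inj₁ (suc i , p)
...   | inj₂ h       = inj₂ λ { zero → e ; (suc i) → h i }

count-at : ∀ {n} (P : Fin n → Bool) v → count (λ i → P i ∧ (i == v)) ≡ ind (P v)
count-at {suc n} P zero =
  trans (cong₂ _+_ (cong ind (BoolP.∧-identityʳ (P zero)))
                   (count-zero (λ i → BoolP.∧-zeroʳ (P (suc i)))))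
        (+-identityʳ (ind (P zero)))
count-at {suc n} P (suc v) =
  cong₂ _+_ (cong ind (BoolP.∧-zeroʳ (P zero))) (count-at (P ∘ suc) v)

count-remove : ∀ {n} (P : Fin n → Bool) v → count P ≡ ind (P v) + count (λ i → P i ∧ not (i == v))
count-remove P v = trans (count-split P (_== v)) (cong (_+ count (λ i → P i ∧ not (i == v))) (count-at P v))

count-remove-member : ∀ {n} (P : Fin n → Bool) v → P v ≡ true →
  count P ≡ suc (count (λ i → P i ∧ not (i == v)))
count-remove-member P v pv =
  trans (count-remove P v) (cong (λ b → ind b + count (λ i → P i ∧ not (i == v))) pv)

count-member : ∀ {n} (P : Fin n → Bool) w → P w ≡ true → 1 ≤ count P
count-member P w pw = subst (1 ≤_) (sym (count-remove-member P w pw)) (s≤s z≤n)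

argmax : ∀ {n} (P : Fin n → Bool) (g : Fin n → ℕ) →
  (Σ (Fin n) λ v → P v ≡ true × (∀ u → P u ≡ true → g u ≤ g v)) ⊎ (∀ i → P i ≡ false)
argmax {zero} P g = inj₂ λ ()
argmax {suc n} P g with argmax (P ∘ suc) (g ∘ suc) | P zero in e0
... | inj₂ h | false = inj₂ λ { zero → e0 ; (suc i) → h i }
... | inj₂ h | true  =
  inj₁ (zero , e0 , λ { zero _ → ≤-refl ; (suc u) pu → ⊥-elim (false≢true (h u) pu) })
... | inj₁ (v , pv , mx) | false =
  inj₁ (suc v , pv , λ { zero pu → ⊥-elim (false≢true e0 pu) ; (suc u) pu → mx u pu })
... | inj₁ (v , pv , mx) | true with g zero ≤? g (suc v)
...   | yes le = inj₁ (suc v , pv , λ { zero _ → le ; (suc u) pu → mx u pu })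
...   | no gt  = inj₁ (zero , e0 , λ { zero _ → ≤-refl ; (suc u) pu → ≤-trans (mx u pu) (≰⇒≥ gt) })

module ℕSum = MonoidSum ℕP.+-0-commutativeMonoid

count-sum : ∀ {n} (P : Fin n → Bool) → count P ≡ ℕSum.sum (λ i → ind (P i))
count-sum {zero}  P = refl
count-sum {suc n} P = cong (ind (P zero) +_) (count-sum (P ∘ suc))

count-permute : ∀ {n} (P : Fin n → Bool) (π : Permutation′ n) → count (λ i → P (π ⟨$⟩ʳ i)) ≡ count P
count-permute P π =
  trans (count-sum (λ i → P (π ⟨$⟩ʳ i)))
        (trans (sym (ℕSum.sum-permute (λ i → ind (P i)) π)) (sym (count-sum P)))

countRange : ℕ → (ℕ → Bool) → ℕ
countRange zero    P = 0
countRange (suc n) P = countRange n P + ind (P n)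

countRange-shift : ∀ n (P : ℕ → Bool) → countRange (suc n) P ≡ ind (P 0) + countRange n (P ∘ suc)
countRange-shift zero    P = +-comm 0 (ind (P 0))
countRange-shift (suc n) P =
  trans (cong (_+ ind (P (suc n))) (countRange-shift n P)) (+-assoc (ind (P 0)) _ _)

count-toℕ : ∀ n (P : ℕ → Bool) → count {n} (λ i → P (toℕ i)) ≡ countRange n P
count-toℕ zero    P = refl
count-toℕ (suc n) P = trans (cong (ind (P 0) +_) (count-toℕ n (P ∘ suc))) (sym (countRange-shift n P))

divmod-% : ∀ a q r → r < suc a → (r + q * suc a) % suc a ≡ r
divmod-% a q r lt = trans ([m+kn]%n≡m%n r q (suc a)) (m<n⇒m%n≡m lt)

divmod-/ : ∀ a q r → r < suc a → (r + q * suc a) / suc a ≡ q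
divmod-/ a q r lt =
  trans (+-distrib-/ r (q * suc a) small) (cong₂ _+_ (m<n⇒m/n≡0 lt) (m*n/n≡m q (suc a)))
  where
  small : r % suc a + (q * suc a) % suc a < suc a
  noRemainder : q * suc a % suc a ≡ 0
  noRemainder = m*n%n≡0 q (suc a)
  small rewrite m<n⇒m%n≡m lt | noRemainder | +-identityʳ r = lt

-- The Fibonacci index of the Turán graph with m vertices and a cliques:
-- with q = m / a and p = m mod a it has p cliques of order q + 1 and a − p of
-- order q, hence (q + 2)^p (q + 1)^(a − p) stable sets.

turanProd : ℕ → ℕ → ℕ → ℕ
turanProd q p a = suc (suc q) ^ p * suc q ^ (a ∸ p)

turanF : ℕ → ℕ → ℕ
turanF m zero    = 1
turanF m (suc a) = turanProd (m / suc a) (m % suc a) (suc a)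

turanF-at : ∀ {a} q r → r < a → turanF (r + q * a) a ≡ turanProd q r a
turanF-at {suc a} q r lt rewrite divmod-/ a q r lt | divmod-% a q r lt = refl

turanF-pos : ∀ m a → 0 < turanF m a
turanF-pos m zero    = s≤s z≤n
turanF-pos m (suc a) =
  *-mono-≤ (m^n>0 (2 + m / suc a) (m % suc a)) (m^n>0 (1 + m / suc a) (suc a ∸ m % suc a))

turanF-multiple : ∀ q a → turanF (q * a) a ≡ suc q ^ a
turanF-multiple q zero    = refl
turanF-multiple q (suc a) = trans (turanF-at q 0 (s≤s z≤n)) (*-identityˡ (suc q ^ suc a))

-- The Pascal-type rule behind the whole proof: adding a vertex to a smallest
-- clique (order q = m / (a+1)) of T_{m,a+1} adds the stable sets containing it,
-- which are those of the Turán graph on the remaining a cliques.  Writing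
-- m = p + q(a+1): if p < a one factor q + 1 becomes q + 2; if p = a all a + 1
-- cliques reach order q + 1.
turanF-step-at : ∀ q p a → p < suc a →
  turanF (suc (p + q * suc a)) (suc a) ≡ turanF (p + q * suc a) (suc a) + turanF (p + q * suc a ∸ q) a
turanF-step-at q p a lt with m≤n⇒m<n∨m≡n (s≤s⁻¹ lt)
... | inj₁ p<a = begin
  turanF (suc p + q * suc a) (suc a)            ≡⟨ turanF-at q (suc p) (s≤s p<a) ⟩
  suc (suc q) * X * Y                            ≡⟨ expand X Y q ⟩
  X * (suc q * Y) + X * Y                        ≡⟨ cong₂ _+_ (cong (λ e → X * suc q ^ e) (sym (+-∸-assoc 1 (<⇒≤ p<a))))
                                                              (sym smaller) ⟩
  turanProd q p (suc a) + turanF (p + q * suc a ∸ q) a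
                                                 ≡⟨ cong (_+ turanF (p + q * suc a ∸ q) a) (sym (turanF-at q p lt)) ⟩
  turanF (p + q * suc a) (suc a) + turanF (p + q * suc a ∸ q) a ∎
  where
  open ≡-Reasoning
  X Y : ℕ
  X = suc (suc q) ^ p
  Y = suc q ^ (a ∸ p)
  expand : ∀ X Y q → suc (suc q) * X * Y ≡ X * (suc q * Y) + X * Y
  expand = solve-∀
  remove : p + q * suc a ∸ q ≡ p + q * a
  remove = trans (cong (_∸ q) (reorder p q a)) (m+n∸n≡m (p + q * a) q)
    where
    reorder : ∀ p q a → p + q * suc a ≡ p + q * a + q
    reorder = solve-∀
  smaller : turanF (p + q * suc a ∸ q) a ≡ X * Y
  smaller = trans (cong (λ m → turanF m a) remove) (turanF-at q p p<a)
... | inj₂ refl = begin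
  turanF (suc (p + q * suc p)) (suc p)          ≡⟨ cong (λ m → turanF m (suc p)) (full p q) ⟩
  turanF (suc q * suc p) (suc p)                 ≡⟨ turanF-multiple (suc q) (suc p) ⟩
  suc (suc q) ^ suc p                            ≡⟨ expand (suc (suc q) ^ p) q ⟩
  suc (suc q) ^ p * suc q ^ 1 + suc (suc q) ^ p  ≡⟨ cong₂ _+_ (cong (λ e → suc (suc q) ^ p * suc q ^ e) (sym (m+n∸n≡m 1 p)) )
                                                              (sym (turanF-multiple (suc q) p)) ⟩
  turanProd q p (suc p) + turanF (suc q * p) p   ≡⟨ cong₂ _+_ (sym (turanF-at q p lt))
                                                              (cong (λ m → turanF m p) (sym remove)) ⟩
  turanF (p + q * suc p) (suc p) + turanF (p + q * suc p ∸ q) p ∎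
  where
  open ≡-Reasoning
  full : ∀ p q → suc (p + q * suc p) ≡ suc q * suc p
  full = solve-∀
  expand : ∀ X q → suc (suc q) * X ≡ X * (suc q * 1) + X
  expand = solve-∀
  remove : p + q * suc p ∸ q ≡ suc q * p
  remove = trans (cong (_∸ q) (reorder p q)) (m+n∸n≡m (suc q * p) q)
    where
    reorder : ∀ p q → p + q * suc p ≡ suc q * p + q
    reorder = solve-∀

turanF-step : ∀ m a → turanF (suc m) (suc a) ≡ turanF m (suc a) + turanF (m ∸ m / suc a) a
turanF-step m a =
  subst (λ x → turanF (suc x) (suc a) ≡ turanF x (suc a) + turanF (x ∸ m / suc a) a)
        (sym (m≡m%n+[m/n]*n m (suc a)))
        (turanF-step-at (m / suc a) (m % suc a) a (m%n<n m (suc a)))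

turanF-<-suc : ∀ m a → turanF m (suc a) < turanF (suc m) (suc a)
turanF-<-suc m a rewrite turanF-step m a =
  subst (_≤ turanF m (suc a) + turanF (m ∸ m / suc a) a) (+-comm (turanF m (suc a)) 1)
        (+-monoʳ-≤ (turanF m (suc a)) (turanF-pos (m ∸ m / suc a) a))

turanF-≤-suc : ∀ m a → turanF m a ≤ turanF (suc m) a
turanF-≤-suc m zero    = ≤-refl
turanF-≤-suc m (suc a) = <⇒≤ (turanF-<-suc m a)

turanF-mono : ∀ {m m'} a → m ≤ m' → turanF m a ≤ turanF m' a
turanF-mono {m} {m'} a le = subst (λ z → turanF m a ≤ turanF z a) (m∸n+n≡m le) (go (m' ∸ m))
  where
  go : ∀ k → turanF m a ≤ turanF (k + m) a
  go zero    = ≤-refl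
  go (suc k) = ≤-trans (go k) (turanF-≤-suc (k + m) a)

turanF-strict : ∀ {m m'} a → m < m' → turanF m (suc a) < turanF m' (suc a)
turanF-strict a lt = <-≤-trans (turanF-<-suc _ a) (turanF-mono (suc a) lt)

-- The classes of the Turán partition: class r of T_{m,a} (the vertices
-- congruent to r mod a) has m / a + [r < m mod a] vertices.

classSize : ℕ → ℕ → ℕ → ℕ
classSize m zero    r = 0
classSize m (suc a) r = m / suc a + ind (r <ᵇ m % suc a)

classSize-0 : ∀ a r → classSize 0 a r ≡ 0
classSize-0 zero    r = refl
classSize-0 (suc a) r = refl

classSize-at : ∀ {a} q p r → p < a → classSize (p + q * a) a r ≡ q + ind (r <ᵇ p)
classSize-at {suc a} q p r lt rewrite divmod-/ a q p lt | divmod-% a q p lt = refl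

classSize-≥ : ∀ m a r → m / suc a ≤ classSize m (suc a) r
classSize-≥ m a r = m≤m+n _ _

classSize-remainder : ∀ m a → classSize m (suc a) (m % suc a) ≡ m / suc a
classSize-remainder m a rewrite <ᵇ-irrefl (m % suc a) = +-identityʳ _

<ᵇ-suc : ∀ r p → ind (r <ᵇ suc p) ≡ ind (p ≡ᵇ r) + ind (r <ᵇ p)
<ᵇ-suc zero    zero    = refl
<ᵇ-suc zero    (suc p) = refl
<ᵇ-suc (suc r) zero    = refl
<ᵇ-suc (suc r) (suc p) = <ᵇ-suc r p

-- Vertex m of T_{m+1,a} lies in class m mod a, which grows by one.
classSize-suc-at : ∀ q p a r → p < suc a → r < suc a →
  classSize (suc (p + q * suc a)) (suc a) r ≡ ind (p ≡ᵇ r) + classSize (p + q * suc a) (suc a) r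
classSize-suc-at q p a r lt r<a rewrite classSize-at q p r lt with m≤n⇒m<n∨m≡n (s≤s⁻¹ lt)
... | inj₁ p<a rewrite classSize-at q (suc p) r (s≤s p<a) | <ᵇ-suc r p = swap q (ind (p ≡ᵇ r)) (ind (r <ᵇ p))
  where
  swap : ∀ x y z → x + (y + z) ≡ y + (x + z)
  swap = solve-∀
... | inj₂ refl = begin
  classSize (suc (p + q * suc p)) (suc p) r   ≡⟨ cong (λ m → classSize m (suc p) r) (full p q) ⟩
  classSize (0 + suc q * suc p) (suc p) r     ≡⟨ classSize-at {suc p} (suc q) 0 r (s≤s z≤n) ⟩
  suc q + 0                                   ≡⟨ cong (_+ 0) (+-comm 1 q) ⟩
  q + 1 + 0                                   ≡⟨ cong (λ x → q + x + 0) (trans (sym (cong ind (<ᵇ-complete r<a))) (<ᵇ-suc r p)) ⟩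
  q + (ind (p ≡ᵇ r) + ind (r <ᵇ p)) + 0       ≡⟨ swap q (ind (p ≡ᵇ r)) (ind (r <ᵇ p)) ⟩
  ind (p ≡ᵇ r) + (q + ind (r <ᵇ p)) ∎
  where
  open ≡-Reasoning
  full : ∀ p q → suc (p + q * suc p) ≡ 0 + suc q * suc p
  full = solve-∀
  swap : ∀ x y z → x + (y + z) + 0 ≡ y + (x + z)
  swap = solve-∀

classSize-suc : ∀ m a r → r < suc a → classSize (suc m) (suc a) r ≡ ind (m % suc a ≡ᵇ r) + classSize m (suc a) r
classSize-suc m a r r<a =
  subst (λ x → classSize (suc x) (suc a) r ≡ ind (m % suc a ≡ᵇ r) + classSize x (suc a) r)
        (sym (m≡m%n+[m/n]*n m (suc a)))
        (classSize-suc-at (m / suc a) (m % suc a) a r (m%n<n m (suc a)) r<a)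

classSize-residues : ∀ m a r → r < suc a → count {m} (λ i → toℕ i % suc a ≡ᵇ r) ≡ classSize m (suc a) r
classSize-residues m a r r<a = trans (count-toℕ m (λ x → x % suc a ≡ᵇ r)) (go m)
  where
  go : ∀ m → countRange m (λ i → i % suc a ≡ᵇ r) ≡ classSize m (suc a) r
  go zero    = refl
  go (suc m) = trans (cong (_+ ind (m % suc a ≡ᵇ r)) (go m))
                     (trans (+-comm _ (ind (m % suc a ≡ᵇ r))) (sym (classSize-suc m a r r<a)))

-- The k-th vertex of class r, namely k·a + r, exists.
classSize-slot : ∀ n a r k → r < suc a → k < classSize n (suc a) r → k * suc a + r < n
classSize-slot n a r k r<a k<size with k <? n / suc a
... | yes k<q = begin-strict
  k * suc a + r        <⟨ +-monoʳ-< (k * suc a) r<a ⟩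
  k * suc a + suc a    ≡⟨ +-comm (k * suc a) (suc a) ⟩
  suc k * suc a        ≤⟨ *-monoˡ-≤ (suc a) k<q ⟩
  n / suc a * suc a    ≤⟨ m/n*n≤m n (suc a) ⟩
  n ∎
  where open ≤-Reasoning
... | no k≮q with r <ᵇ n % suc a in e
...   | false = ⊥-elim (k≮q (subst (k <_) (+-identityʳ _) k<size))
...   | true  = begin-strict
  k * suc a + r                  ≡⟨ cong (λ z → z * suc a + r) k≡q ⟩
  n / suc a * suc a + r          <⟨ +-monoʳ-< (n / suc a * suc a) (<ᵇ⇒< r (n % suc a) (subst T (sym e) _)) ⟩
  n / suc a * suc a + n % suc a  ≡⟨ +-comm (n / suc a * suc a) (n % suc a) ⟩
  n % suc a + n / suc a * suc a  ≡⟨ sym (m≡m%n+[m/n]*n n (suc a)) ⟩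
  n ∎
  where
  open ≤-Reasoning
  k≡q : k ≡ n / suc a
  k≡q = ≤-antisym (s≤s⁻¹ (subst (k <_) (+-comm _ 1) k<size)) (≮⇒≥ k≮q)

prodRange : ℕ → (ℕ → ℕ) → ℕ
prodRange zero    h = 1
prodRange (suc a) h = prodRange a h * h a

prodRange-ext : ∀ a {h h' : ℕ → ℕ} → (∀ r → r < a → h r ≡ h' r) → prodRange a h ≡ prodRange a h'
prodRange-ext zero    e = refl
prodRange-ext (suc a) e = cong₂ _*_ (prodRange-ext a (λ r lt → e r (m<n⇒m<1+n lt))) (e a ≤-refl)

prodRange-1 : ∀ a → prodRange a (λ _ → 1) ≡ 1
prodRange-1 zero    = refl
prodRange-1 (suc a) = trans (*-identityʳ _) (prodRange-1 a)

omit : ℕ → (ℕ → ℕ) → ℕ → ℕ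
omit r₀ h r = if r₀ ≡ᵇ r then 1 else h r

prodRange-extract : ∀ a (h : ℕ → ℕ) r₀ → r₀ < a → prodRange a h ≡ h r₀ * prodRange a (omit r₀ h)
prodRange-extract (suc a) h r₀ lt with m≤n⇒m<n∨m≡n (s≤s⁻¹ lt)
... | inj₁ r₀<a rewrite ≡ᵇ-false {r₀} {a} (<⇒≢ r₀<a) | prodRange-extract a h r₀ r₀<a = *-assoc (h r₀) _ (h a)
... | inj₂ refl rewrite ≡ᵇ-complete {r₀} refl = begin
  prodRange r₀ h * h r₀            ≡⟨ cong (_* h r₀) (prodRange-ext r₀ below) ⟩
  R * h r₀                         ≡⟨ *-comm R (h r₀) ⟩
  h r₀ * R                         ≡⟨ cong (h r₀ *_) (sym (*-identityʳ R)) ⟩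
  h r₀ * (R * 1) ∎
  where
  open ≡-Reasoning
  R : ℕ
  R = prodRange r₀ (omit r₀ h)
  below : ∀ r → r < r₀ → h r ≡ omit r₀ h r
  below r r<r₀ rewrite ≡ᵇ-false {r₀} {r} (λ e → <⇒≢ r<r₀ (sym e)) = refl

prodRange-omit-cong : ∀ a r₀ {h h' : ℕ → ℕ} → (∀ r → (r₀ ≡ᵇ r) ≡ false → h r ≡ h' r) →
  prodRange a (omit r₀ h) ≡ prodRange a (omit r₀ h')
prodRange-omit-cong a r₀ {h} {h'} e = prodRange-ext a agree
  where
  agree : ∀ r → r < a → omit r₀ h r ≡ omit r₀ h' r
  agree r _ with r₀ ≡ᵇ r in eq
  ... | true  = refl
  ... | false = e r eq

prodRange-classSize : ∀ m a → prodRange a (λ r → suc (classSize m a r)) ≡ turanF m a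
prodRange-classSize m zero     = refl
prodRange-classSize m (suc a) =
  trans (cong (λ z → prodRange z (λ r → suc (q + ind (r <ᵇ p)))) (sym (m+[n∸m]≡n (<⇒≤ (m%n<n m (suc a))))))
        (split (suc a ∸ p))
  where
  q p : ℕ
  q = m / suc a
  p = m % suc a
  large : ∀ k → k ≤ p → prodRange k (λ r → suc (q + ind (r <ᵇ p))) ≡ suc (suc q) ^ k
  large zero    _  = refl
  large (suc k) le rewrite large k (<⇒≤ le) | <ᵇ-complete le | +-comm q 1 =
    *-comm (suc (suc q) ^ k) (suc (suc q))
  split : ∀ j → prodRange (p + j) (λ r → suc (q + ind (r <ᵇ p))) ≡ suc (suc q) ^ p * suc q ^ j
  split zero rewrite +-identityʳ p = trans (large p ≤-refl) (sym (*-identityʳ _))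
  split (suc j) rewrite +-suc p j | split j | <ᵇ-false {p + j} {p} (λ lt → <⇒≱ lt (m≤m+n p j))
    | +-identityʳ q = reassoc (suc (suc q) ^ p) (suc q ^ j) (suc q)
    where
    reassoc : ∀ x y z → x * y * z ≡ x * (z * y)
    reassoc = solve-∀

ceil-nondivisible : ∀ n a p → n % suc a ≡ suc p → (n + a) / suc a ≡ suc (n / suc a)
ceil-nondivisible n a p e = trans (cong (_/ suc a) shape) (divmod-/ a (suc q) p p<a)
  where
  q : ℕ
  q = n / suc a
  p<a : p < suc a
  p<a = <⇒≤ (subst (_< suc a) e (m%n<n n (suc a)))
  reorder : ∀ p q a → suc p + q * suc a + a ≡ p + suc q * suc a
  reorder = solve-∀
  shape : n + a ≡ p + suc q * suc a
  shape = trans (cong (_+ a) (trans (m≡m%n+[m/n]*n n (suc a)) (cong (_+ q * suc a) e))) (reorder p q a)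

turanF-closedForm : ∀ n a →
  turanF n (suc a) ≡ ((n + a) / suc a + 1) ^ (n % suc a) * (n / suc a + 1) ^ (suc a ∸ n % suc a)
turanF-closedForm n a =
  cong₂ (λ x y → x * y ^ (suc a ∸ n % suc a)) (powers (n % suc a) refl) (+-comm 1 (n / suc a))
  where
  powers : ∀ p → p ≡ n % suc a → suc (suc (n / suc a)) ^ p ≡ ((n + a) / suc a + 1) ^ p
  powers zero    _ = refl
  powers (suc p) e =
    cong (_^ suc p) (sym (trans (cong (_+ 1) (ceil-nondivisible n a p (sym e))) (+-comm _ 1)))

quotient-shrink : ∀ m b → m / suc (suc b) ≤ (m ∸ m / suc (suc b)) / suc b
quotient-shrink m b = subst (_≤ (m ∸ q) / suc b) (m*n/n≡m q (suc b)) (/-monoˡ-≤ (suc b) rest)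
  where
  q : ℕ
  q = m / suc (suc b)
  whole : q + q * suc b ≤ m
  whole = subst (_≤ m) (*-suc q (suc b)) (m/n*n≤m m (suc (suc b)))
  rest : q * suc b ≤ m ∸ q
  rest = subst (_≤ m ∸ q) (m+n∸m≡n q (q * suc b)) (∸-monoˡ-≤ q whole)

quotient-≤ : ∀ m a d → suc m ≤ suc a * suc d → m / suc a ≤ d
quotient-≤ m a d le with m / suc a ≤? d
... | yes p = p
... | no ¬p = ⊥-elim (<-irrefl refl (≤-trans le (≤-trans big (m/n*n≤m m (suc a)))))
  where
  big : suc a * suc d ≤ m / suc a * suc a
  big = subst (_≤ m / suc a * suc a) (*-comm (suc d) (suc a)) (*-monoˡ-≤ (suc a) (≰⇒> ¬p))

tight-split : ∀ {x y X Y : ℕ} → x ≤ X → y ≤ Y → x + y ≡ X + Y → x ≡ X × y ≡ Y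
tight-split {x} {y} {X} {Y} x≤X y≤Y e with m≤n⇒m<n∨m≡n x≤X
... | inj₂ x≡X = x≡X , +-cancelˡ-≡ X y Y (trans (cong (_+ y) (sym x≡X)) e)
... | inj₁ x<X = ⊥-elim (<-irrefl e (+-mono-<-≤ x<X y≤Y))

module Transposition (k l : ℕ) where

  swap : ℕ → ℕ
  swap x = if x ≡ᵇ k then l else (if x ≡ᵇ l then k else x)

  swap-k : swap k ≡ l
  swap-k rewrite ≡ᵇ-complete {k} refl = refl

  swap-l : swap l ≡ k
  swap-l with l ℕP.≟ k
  ... | yes e rewrite ≡ᵇ-complete e = e
  ... | no ne rewrite ≡ᵇ-false ne | ≡ᵇ-complete {l} refl = refl

  swap-other : ∀ x → x ≢ k → x ≢ l → swap x ≡ x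
  swap-other x x≢k x≢l rewrite ≡ᵇ-false x≢k | ≡ᵇ-false x≢l = refl

  swap-cases : ∀ x → (x ≡ k × swap x ≡ l) ⊎ (x ≡ l × swap x ≡ k) ⊎ (x ≢ k × x ≢ l × swap x ≡ x)
  swap-cases x with x ℕP.≟ k | x ℕP.≟ l
  ... | yes refl | _        = inj₁ (refl , swap-k)
  ... | no x≢k   | yes refl = inj₂ (inj₁ (refl , swap-l))
  ... | no x≢k   | no x≢l   = inj₂ (inj₂ (x≢k , x≢l , swap-other x x≢k x≢l))

  swap-involutive : ∀ x → swap (swap x) ≡ x
  swap-involutive x with swap-cases x
  ... | inj₁ (refl , e)               rewrite e = swap-l
  ... | inj₂ (inj₁ (refl , e))        rewrite e = swap-k
  ... | inj₂ (inj₂ (x≢k , x≢l , e))   rewrite e = e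

  swap-injective : ∀ {x y} → swap x ≡ swap y → x ≡ y
  swap-injective {x} {y} e = trans (sym (swap-involutive x)) (trans (cong swap e) (swap-involutive y))

  swap-≡ᵇ : ∀ x r → (swap x ≡ᵇ r) ≡ (x ≡ᵇ swap r)
  swap-≡ᵇ x r = true-ext
    (λ h → ≡ᵇ-complete (trans (sym (swap-involutive x)) (cong swap (≡ᵇ-sound {swap x} {r} h))))
    (λ h → ≡ᵇ-complete (trans (cong swap (≡ᵇ-sound {x} {swap r} h)) (swap-involutive r)))

  swap-< : ∀ {a x} → k < a → l < a → x < a → swap x < a
  swap-< {x = x} k<a l<a x<a with swap-cases x
  ... | inj₁ (_ , e)               = subst (_< _) (sym e) l<a
  ... | inj₂ (inj₁ (_ , e))        = subst (_< _) (sym e) k<a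
  ... | inj₂ (inj₂ (_ , _ , e))    = subst (_< _) (sym e) x<a

  swap-invariant : ∀ (h : ℕ → ℕ) → h k ≡ h l → ∀ x → h (swap x) ≡ h x
  swap-invariant h hk≡hl x with swap-cases x
  ... | inj₁ (refl , e)               rewrite e = sym hk≡hl
  ... | inj₂ (inj₁ (refl , e))        rewrite e = hk≡hl
  ... | inj₂ (inj₂ (_ , _ , e))       rewrite e = refl

allF : ∀ {n} → (Fin n → Bool) → Bool
allF {zero}  P = true
allF {suc n} P = P zero ∧ allF (P ∘ suc)

allF-sound : ∀ {n} {P : Fin n → Bool} → allF P ≡ true → ∀ i → P i ≡ true
allF-sound {suc n} e zero = ∧-trueˡ e
allF-sound {suc n} {P} e (suc i) = allF-sound {n} (∧-trueʳ {P zero} e) i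

allF-complete : ∀ {n} {P : Fin n → Bool} → (∀ i → P i ≡ true) → allF P ≡ true
allF-complete {zero}  h = refl
allF-complete {suc n} h = ∧-true (h zero) (allF-complete (h ∘ suc))

allF-cong : ∀ {n} {P Q : Fin n → Bool} → (∀ i → P i ≡ Q i) → allF P ≡ allF Q
allF-cong {zero}  e = refl
allF-cong {suc n} e = cong₂ _∧_ (e zero) (allF-cong (e ∘ suc))

all-tabulate : ∀ {n} {X : Set} (p : X → Bool) (h : Fin n → X) → all p (tabulate h) ≡ allF (p ∘ h)
all-tabulate {zero}  p h = refl
all-tabulate {suc n} p h = cong (p (h zero) ∧_) (all-tabulate p (h ∘ suc))

∈-subsets : ∀ {n} (s : Vec Bool n) → s ∈ subsets n
∈-subsets [] = here refl
∈-subsets {suc n} (false ∷ s) = ∈-++⁺ˡ (∈-map⁺ (false ∷_) (∈-subsets s))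
∈-subsets {suc n} (true ∷ s)  = ∈-++⁺ʳ (map (false ∷_) (subsets n)) (∈-map⁺ (true ∷_) (∈-subsets s))

card-insert : ∀ {n} (s : Vec Bool n) v → lookup s v ≡ false → card (s [ v ]≔ true) ≡ suc (card s)
card-insert (false ∷ s) zero    e = refl
card-insert (true  ∷ s) (suc v) e = cong suc (card-insert s v e)
card-insert (false ∷ s) (suc v) e = card-insert s v e

card-empty : ∀ n → card (replicate n false) ≡ 0
card-empty zero    = refl
card-empty (suc n) = card-empty n

VSet : ℕ → Set
VSet n = Fin n → Bool

_⊆_ : ∀ {n} → VSet n → VSet n → Set
A ⊆ B = ∀ i → A i ≡ true → B i ≡ true

everything : ∀ {n} → VSet n
everything _ = true

module StableSets {n} (G : Graph n) where

  _∖_ : VSet n → Fin n → VSet n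
  (A ∖ v) i = A i ∧ not (i == v)

  _∖N[_] : VSet n → Fin n → VSet n
  (A ∖N[ v ]) i = A i ∧ not (i == v) ∧ not (adj G v i)

  ∖-⊆ : ∀ A v → (A ∖ v) ⊆ A
  ∖-⊆ A v i = ∧-trueˡ

  ∖N-⊆∖ : ∀ A v → (A ∖N[ v ]) ⊆ (A ∖ v)
  ∖N-⊆∖ A v i e = ∧-true (∧-trueˡ e) (∧-trueˡ {not (i == v)} (∧-trueʳ {A i} e))

  ∖N-⊆ : ∀ A v → (A ∖N[ v ]) ⊆ A
  ∖N-⊆ A v i = ∧-trueˡ

  ∈∖-elim : ∀ A v i → (A ∖ v) i ≡ true → A i ≡ true × i ≢ v
  ∈∖-elim A v i e = ∧-trueˡ e , λ { refl → false≢true (not-true (∧-trueʳ {A i} e)) (==-refl i) }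

  ∈∖-intro : ∀ A v i → A i ≡ true → i ≢ v → (A ∖ v) i ≡ true
  ∈∖-intro A v i a ne = ∧-true a (not-false (==-false ne))

  ∈∖N-elim : ∀ A v i → (A ∖N[ v ]) i ≡ true → A i ≡ true × i ≢ v × adj G v i ≡ false
  ∈∖N-elim A v i e with ∈∖-elim A v i (∖N-⊆∖ A v i e)
  ... | a , ne = a , ne , not-true (∧-trueʳ {not (i == v)} (∧-trueʳ {A i} e))

  ∈∖N-intro : ∀ A v i → A i ≡ true → i ≢ v → adj G v i ≡ false → (A ∖N[ v ]) i ≡ true
  ∈∖N-intro A v i a ne ad = ∧-true a (∧-true (not-false (==-false ne)) (not-false ad))

  Stable : Vec Bool n → Set
  Stable s = ∀ i j → lookup s i ≡ true → lookup s j ≡ true → adj G i j ≡ false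

  Within : Vec Bool n → VSet n → Set
  Within s A = ∀ i → lookup s i ≡ true → A i ≡ true

  isStable-allF : ∀ s → isStable G s ≡ allF (λ i → allF (λ j → not (lookup s i ∧ lookup s j ∧ adj G i j)))
  isStable-allF s =
    trans (all-tabulate (λ i → all (λ j → not (lookup s i ∧ lookup s j ∧ adj G i j)) (allFin n)) (λ i → i))
          (allF-cong (λ i → all-tabulate (λ j → not (lookup s i ∧ lookup s j ∧ adj G i j)) (λ j → j)))

  isStable-sound : ∀ s → isStable G s ≡ true → Stable s
  isStable-sound s e i j si sj with adj G i j in ea
  ... | false = refl
  ... | true  = ⊥-elim (false≢true refuted (allF-sound (allF-sound (trans (sym (isStable-allF s)) e) i) j))
    where
    refuted : not (lookup s i ∧ lookup s j ∧ adj G i j) ≡ false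
    refuted rewrite si | sj | ea = refl

  isStable-complete : ∀ s → Stable s → isStable G s ≡ true
  isStable-complete s h = trans (isStable-allF s) (allF-complete λ i → allF-complete λ j → pair i j)
    where
    pair : ∀ i j → not (lookup s i ∧ lookup s j ∧ adj G i j) ≡ true
    pair i j with lookup s i in e1 | lookup s j in e2
    ... | false | _     = refl
    ... | true  | false = refl
    ... | true  | true rewrite h i j e1 e2 = refl

  within : Vec Bool n → VSet n → Bool
  within s A = allF (λ i → not (lookup s i) ∨ A i)

  within-sound : ∀ s A → within s A ≡ true → Within s A
  within-sound s A e i si with allF-sound e i
  ... | h rewrite si = h

  within-complete : ∀ s A → Within s A → within s A ≡ true
  within-complete s A h = allF-complete member
    where
    member : ∀ i → not (lookup s i) ∨ A i ≡ true
    member i with lookup s i in e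
    ... | false = refl
    ... | true  = h i e

  stableIn : Vec Bool n → VSet n → Bool
  stableIn s A = isStable G s ∧ within s A

  stableIn-sound : ∀ s A → stableIn s A ≡ true → Stable s × Within s A
  stableIn-sound s A e = isStable-sound s (∧-trueˡ e) , within-sound s A (∧-trueʳ {isStable G s} e)

  stableIn-complete : ∀ s A → Stable s → Within s A → stableIn s A ≡ true
  stableIn-complete s A st w = ∧-true (isStable-complete s st) (within-complete s A w)

  #stable : VSet n → ℕ
  #stable A = countSubsets n (λ s → stableIn s A)

  fibIndex-#stable : fibIndex G ≡ #stable everything
  fibIndex-#stable = trans (countL-filter (isStable G) (subsets n)) (countL-ext whole (subsets n))
    where
    whole : ∀ s → isStable G s ≡ stableIn s everything
    whole s = trans (sym (BoolP.∧-identityʳ (isStable G s)))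
                    (cong (isStable G s ∧_) (sym (within-complete s everything (λ _ _ → refl))))

  stableIn-avoid : ∀ A v s → stableIn s A ∧ not (lookup s v) ≡ stableIn s (A ∖ v)
  stableIn-avoid A v s = true-ext forward backward
    where
    forward : stableIn s A ∧ not (lookup s v) ≡ true → stableIn s (A ∖ v) ≡ true
    forward e with stableIn-sound s A (∧-trueˡ e)
    ... | st , w = stableIn-complete s (A ∖ v) st λ i si →
      ∈∖-intro A v i (w i si) λ { refl → false≢true (not-true (∧-trueʳ {stableIn s A} e)) si }
    backward : stableIn s (A ∖ v) ≡ true → stableIn s A ∧ not (lookup s v) ≡ true
    backward e with stableIn-sound s (A ∖ v) e
    ... | st , w = ∧-true (stableIn-complete s A st (λ i si → ∖-⊆ A v i (w i si))) (not-false v∉s)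
      where
      v∉s : lookup s v ≡ false
      v∉s with lookup s v in e'
      ... | false = refl
      ... | true  = ⊥-elim (proj₂ (∈∖-elim A v v (w v e')) refl)

  lookup-insert : ∀ (s : Vec Bool n) v → lookup (s [ v ]≔ true) v ≡ true
  lookup-insert s v = lookup∘update v s true

  lookup-insert-other : ∀ (s : Vec Bool n) {v i} → i ≢ v → lookup (s [ v ]≔ true) i ≡ lookup s i
  lookup-insert-other s ne = lookup∘update′ ne s true

  stableIn-insert : ∀ A v → A v ≡ true → ∀ s →
    not (lookup s v) ∧ stableIn (s [ v ]≔ true) A ≡ stableIn s (A ∖N[ v ])
  stableIn-insert A v av s = true-ext forward backward
    where
    s⁺ : Vec Bool n
    s⁺ = s [ v ]≔ true
    forward : not (lookup s v) ∧ stableIn s⁺ A ≡ true → stableIn s (A ∖N[ v ]) ≡ true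
    forward e with stableIn-sound s⁺ A (∧-trueʳ {not (lookup s v)} e)
    ... | st , w = stableIn-complete s (A ∖N[ v ]) st′ w′
      where
      v∉s : lookup s v ≡ false
      v∉s = not-true (∧-trueˡ e)
      ≢v : ∀ {i} → lookup s i ≡ true → i ≢ v
      ≢v si refl = false≢true v∉s si
      in⁺ : ∀ {i} → lookup s i ≡ true → lookup s⁺ i ≡ true
      in⁺ si = trans (lookup-insert-other s (≢v si)) si
      st′ : Stable s
      st′ i j si sj = st i j (in⁺ si) (in⁺ sj)
      w′ : Within s (A ∖N[ v ])
      w′ i si = ∈∖N-intro A v i (w i (in⁺ si)) (≢v si) (st v i (lookup-insert s v) (in⁺ si))
    backward : stableIn s (A ∖N[ v ]) ≡ true → not (lookup s v) ∧ stableIn s⁺ A ≡ true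
    backward e with stableIn-sound s (A ∖N[ v ]) e
    ... | st , w = ∧-true (not-false v∉s) (stableIn-complete s⁺ A st⁺ w⁺)
      where
      v∉s : lookup s v ≡ false
      v∉s with lookup s v in e'
      ... | false = refl
      ... | true  = ⊥-elim (proj₁ (proj₂ (∈∖N-elim A v v (w v e'))) refl)
      old : ∀ i → i ≢ v → lookup s⁺ i ≡ true → lookup s i ≡ true
      old i ne e'' = trans (sym (lookup-insert-other s ne)) e''
      st⁺ : Stable s⁺
      st⁺ i j si sj with i ≟ v | j ≟ v
      ... | yes refl | yes refl = adj-irrefl G v
      ... | yes refl | no j≢v   = proj₂ (proj₂ (∈∖N-elim A v j (w j (old j j≢v sj))))
      ... | no i≢v   | yes refl = trans (adj-sym G i v) (proj₂ (proj₂ (∈∖N-elim A v i (w i (old i i≢v si)))))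
      ... | no i≢v   | no j≢v   = st i j (old i i≢v si) (old j j≢v sj)
      w⁺ : Within s⁺ A
      w⁺ i si with i ≟ v
      ... | yes refl = av
      ... | no i≢v   = proj₁ (∈∖N-elim A v i (w i (old i i≢v si)))

  -- The deletion recurrence: split the stable sets of A by whether they contain v.
  #stable-deletion : ∀ A v → A v ≡ true → #stable A ≡ #stable (A ∖ v) + #stable (A ∖N[ v ])
  #stable-deletion A v av = begin
    #stable A
      ≡⟨ countL-split (λ s → stableIn s A) (λ s → lookup s v) (subsets n) ⟩
    Cnt (λ s → stableIn s A ∧ lookup s v) + Cnt (λ s → stableIn s A ∧ not (lookup s v))
      ≡⟨ +-comm (Cnt (λ s → stableIn s A ∧ lookup s v)) _ ⟩
    Cnt (λ s → stableIn s A ∧ not (lookup s v)) + Cnt (λ s → stableIn s A ∧ lookup s v)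
      ≡⟨ cong₂ _+_ (countSubsets-ext n (stableIn-avoid A v))
                   (countSubsets-ext n (λ s → BoolP.∧-comm (stableIn s A) (lookup s v))) ⟩
    #stable (A ∖ v) + Cnt (λ s → lookup s v ∧ stableIn s A)
      ≡⟨ cong (#stable (A ∖ v) +_) (countSubsets-insert n v (λ s → stableIn s A)) ⟩
    #stable (A ∖ v) + Cnt (λ s → not (lookup s v) ∧ stableIn (s [ v ]≔ true) A)
      ≡⟨ cong (#stable (A ∖ v) +_) (countSubsets-ext n (stableIn-insert A v av)) ⟩
    #stable (A ∖ v) + #stable (A ∖N[ v ]) ∎
    where
    open ≡-Reasoning
    Cnt : (Vec Bool n → Bool) → ℕ
    Cnt = countSubsets n

  #stable-empty : ∀ A → (∀ i → A i ≡ false) → #stable A ≡ 1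
  #stable-empty A none = trans (countSubsets-ext n onlyEmpty) (countSubsets-isEmpty n)
    where
    onlyEmpty : ∀ s → stableIn s A ≡ isEmpty s
    onlyEmpty s = true-ext
      (λ st → isEmpty-complete s (λ i → outside i (proj₂ (stableIn-sound s A st) i)))
      (λ z → stableIn-complete s A (λ i j si _ → ⊥-elim (false≢true (isEmpty-sound s z i) si))
                                   (λ i si → ⊥-elim (false≢true (isEmpty-sound s z i) si)))
      where
      outside : ∀ i → (lookup s i ≡ true → A i ≡ true) → lookup s i ≡ false
      outside i g with lookup s i
      ... | false = refl
      ... | true  = ⊥-elim (false≢true (none i) (g refl))

  Bounded : VSet n → ℕ → Set
  Bounded A a = ∀ s → stableIn s A ≡ true → card s ≤ a

  stabilityNumber-Bounded : ∀ α → stabilityNumber G ≡ α → Bounded everything α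
  stabilityNumber-Bounded α e s st = subst (card s ≤_) e (max-≥ (subsets n) (∈-subsets s) (∧-trueˡ st))
    where
    max-≥ : ∀ (xs : List (Vec Bool n)) {s} → s ∈ xs → isStable G s ≡ true →
      card s ≤ foldr _⊔_ 0 (map card (filter (λ s → isStable G s BoolP.≟ true) xs))
    max-≥ (x ∷ xs) {s} (here refl) e rewrite e = m≤m⊔n (card s) _
    max-≥ (x ∷ xs) (there mem) e with isStable G x
    ... | true  = ≤-trans (max-≥ xs mem e) (m≤n⊔m (card x) _)
    ... | false = max-≥ xs mem e

  Bounded-⊆ : ∀ {A B a} → B ⊆ A → Bounded A a → Bounded B a
  Bounded-⊆ {A} {B} B⊆A bnd s e with stableIn-sound s B e
  ... | st , w = bnd s (stableIn-complete s A st (λ i si → B⊆A i (w i si)))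

  -- Adding v to a stable set of A ∖ N[v] gives a larger stable set of A.
  Bounded-∖N : ∀ {A a} v → A v ≡ true → Bounded A (suc a) → Bounded (A ∖N[ v ]) a
  Bounded-∖N {A} v av bnd s e =
    s≤s⁻¹ (subst (_≤ _) (card-insert s v v∉s) (bnd (s [ v ]≔ true) (∧-trueʳ {not (lookup s v)} inserted)))
    where
    inserted : not (lookup s v) ∧ stableIn (s [ v ]≔ true) A ≡ true
    inserted = trans (stableIn-insert A v av s) e
    v∉s : lookup s v ≡ false
    v∉s = not-true (∧-trueˡ inserted)

  -- A nonempty vertex set contains the stable set {v}.
  Bounded-0 : ∀ {A} v → A v ≡ true → ¬ Bounded A 0
  Bounded-0 {A} v av bnd = 1+n≰n (subst (_≤ 0) card-singleton (bnd (∅ [ v ]≔ true) (∧-trueʳ {not (lookup ∅ v)} inserted)))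
    where
    ∅ : Vec Bool n
    ∅ = replicate n false
    ∅-stable : stableIn ∅ (A ∖N[ v ]) ≡ true
    ∅-stable = stableIn-complete ∅ (A ∖N[ v ]) (λ i j si _ → ⊥-elim (false≢true (lookup-replicate i false) si))
                                             (λ i si → ⊥-elim (false≢true (lookup-replicate i false) si))
    inserted : not (lookup ∅ v) ∧ stableIn (∅ [ v ]≔ true) A ≡ true
    inserted = trans (stableIn-insert A v av ∅) ∅-stable
    card-singleton : card (∅ [ v ]≔ true) ≡ 1
    card-singleton = trans (card-insert ∅ v (lookup-replicate v false)) (cong suc (card-empty n))

  Bounded-0-empty : ∀ {B} → Bounded B 0 → count B ≡ 0
  Bounded-0-empty {B} bnd with find B
  ... | inj₁ (w , bw) = ⊥-elim (Bounded-0 w bw bnd)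
  ... | inj₂ none     = count-zero none

  deg : VSet n → Fin n → ℕ
  deg A u = count (λ w → A w ∧ adj G u w)

  deg-mono : ∀ {A B} u → B ⊆ A → deg B u ≤ deg A u
  deg-mono {A} {B} u B⊆A = count-mono λ i e → ∧-true (B⊆A i (∧-trueˡ e)) (∧-trueʳ {B i} e)

  deg-∖ : ∀ A v u → A v ≡ true → adj G u v ≡ true → deg A u ≡ suc (deg (A ∖ v) u)
  deg-∖ A v u av auv = trans (count-remove-member (λ w → A w ∧ adj G u w) v (∧-true av auv))
                             (cong suc (count-ext (λ w → swap (A w) (adj G u w) (not (w == v)))))
    where
    swap : ∀ a b c → (a ∧ b) ∧ c ≡ (a ∧ c) ∧ b
    swap true  true  c = sym (BoolP.∧-identityʳ c)
    swap true  false c = sym (BoolP.∧-zeroʳ c)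
    swap false b     c = refl

  -- v is not its own neighbour, so deleting it does not change its degree.
  deg-∖-self : ∀ A v → deg (A ∖ v) v ≡ deg A v
  deg-∖-self A v = count-ext same
    where
    same : ∀ w → (A ∖ v) w ∧ adj G v w ≡ A w ∧ adj G v w
    same w with w ≟ v
    ... | yes refl rewrite adj-irrefl G w = trans (BoolP.∧-zeroʳ _) (sym (BoolP.∧-zeroʳ _))
    ... | no w≢v   rewrite ==-false w≢v = cong (_∧ adj G v w) (BoolP.∧-identityʳ (A w))

  count-∖-∖N : ∀ A v → count (A ∖ v) ≡ deg A v + count (A ∖N[ v ])
  count-∖-∖N A v = trans (count-split (A ∖ v) (adj G v))
    (cong₂ _+_ (deg-∖-self A v) (count-ext (λ i → BoolP.∧-assoc (A i) (not (i == v)) (not (adj G v i)))))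

  -- Greedy bound: if stable sets in A have at most a elements and all degrees
  -- in A are at most D, then |A| ≤ a (D + 1) (repeatedly pick v and delete N[v]).
  greedy : ∀ a A D → Bounded A a → (∀ u → A u ≡ true → deg A u ≤ D) → count A ≤ a * suc D
  greedy zero A D bnd _ = ≤-reflexive (Bounded-0-empty bnd)
  greedy (suc a) A D bnd maxDeg with find A
  ... | inj₂ none    = subst (_≤ suc a * suc D) (sym (count-zero none)) z≤n
  ... | inj₁ (v , av) = subst (_≤ suc a * suc D) (sym (trans (count-remove-member A v av) (cong suc (count-∖-∖N A v))))
      (+-mono-≤ (s≤s (maxDeg v av))
                (greedy a (A ∖N[ v ]) D (Bounded-∖N v av bnd)
                        (λ u u∈ → ≤-trans (deg-mono u (∖N-⊆ A v)) (maxDeg u (∖N-⊆ A v u u∈)))))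

  record Pivot (A : VSet n) : Set where
    field
      v       : Fin n
      v∈A     : A v ≡ true
      maximal : ∀ u → A u ≡ true → deg A u ≤ deg A v

  pivot : ∀ A → Pivot A ⊎ (∀ i → A i ≡ false)
  pivot A with argmax A (deg A)
  ... | inj₁ (v , av , mx) = inj₁ (record { v = v ; v∈A = av ; maximal = mx })
  ... | inj₂ none          = inj₂ none

  module PivotFacts {A a} (P : Pivot A) (bnd : Bounded A (suc a)) where
    open Pivot P

    m : ℕ
    m = count (A ∖ v)

    count-A : count A ≡ suc m
    count-A = count-remove-member A v v∈A

    count-∖N : count (A ∖N[ v ]) ≡ m ∸ deg A v
    count-∖N = trans (sym (m+n∸m≡n (deg A v) _)) (cong (_∸ deg A v) (sym (count-∖-∖N A v)))

    deg-≤ : deg A v ≤ m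
    deg-≤ = subst (deg A v ≤_) (sym (count-∖-∖N A v)) (m≤m+n _ _)

    deg-≥ : m / suc a ≤ deg A v
    deg-≥ = quotient-≤ m a (deg A v)
      (subst (_≤ suc a * suc (deg A v)) count-A (greedy (suc a) A (deg A v) bnd maximal))

    ∖N-small : count (A ∖N[ v ]) ≤ m ∸ m / suc a
    ∖N-small = subst (_≤ m ∸ m / suc a) (sym count-∖N) (∸-monoʳ-≤ m deg-≥)

  bound-suc : ∀ (A : VSet n) {k} v → A v ≡ true → count A ≤ k → Σ ℕ λ k' → k ≡ suc k'
  bound-suc A {zero}   v av le = ⊥-elim (1+n≰n (≤-trans (count-member A v av) le))
  bound-suc A {suc k'} v av le = k' , refl

  upperBound : ∀ k a A → count A ≤ k → Bounded A a → #stable A ≤ turanF (count A) a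
  upperBound k a A le bnd with pivot A
  ... | inj₂ none = subst (_≤ turanF (count A) a) (sym (#stable-empty A none)) (turanF-pos (count A) a)
  ... | inj₁ P with a
  ...   | zero  = ⊥-elim (Bounded-0 (Pivot.v P) (Pivot.v∈A P) bnd)
  ...   | suc a with bound-suc A (Pivot.v P) (Pivot.v∈A P) le
  ...     | k' , refl = subst (λ z → #stable A ≤ turanF z (suc a)) (sym count-A) (begin
    #stable A                                      ≡⟨ #stable-deletion A v v∈A ⟩
    #stable (A ∖ v) + #stable (A ∖N[ v ])          ≤⟨ +-mono-≤ rest neighbours ⟩
    turanF m (suc a) + turanF (m ∸ m / suc a) a    ≡⟨ sym (turanF-step m a) ⟩
    turanF (suc m) (suc a) ∎)
    where
    open ≤-Reasoning
    open Pivot P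
    open PivotFacts P bnd
    m≤k' : m ≤ k'
    m≤k' = s≤s⁻¹ (subst (_≤ suc k') count-A le)
    rest : #stable (A ∖ v) ≤ turanF m (suc a)
    rest = upperBound k' (suc a) (A ∖ v) m≤k' (Bounded-⊆ (∖-⊆ A v) bnd)
    neighbours : #stable (A ∖N[ v ]) ≤ turanF (m ∸ m / suc a) a
    neighbours = ≤-trans (upperBound k' a (A ∖N[ v ]) (≤-trans (count-mono (∖N-⊆∖ A v)) m≤k') (Bounded-∖N v v∈A bnd))
                         (turanF-mono a ∖N-small)

  -- lab splits A into at most a cliques with no edges between them: two
  -- distinct vertices of A are adjacent exactly when their labels agree.
  record Cluster (A : VSet n) (a : ℕ) (lab : Fin n → ℕ) : Set where
    field
      label<   : ∀ i → A i ≡ true → lab i < a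
      adj⇒same : ∀ i j → A i ≡ true → A j ≡ true → i ≢ j → adj G i j ≡ true → lab i ≡ lab j
      same⇒adj : ∀ i j → A i ≡ true → A j ≡ true → i ≢ j → lab i ≡ lab j → adj G i j ≡ true

  Cluster-⊆ : ∀ {A B a lab} → B ⊆ A → Cluster A a lab → Cluster B a lab
  Cluster-⊆ B⊆A cl = record
    { label<   = λ i bi → label< i (B⊆A i bi)
    ; adj⇒same = λ i j bi bj → adj⇒same i j (B⊆A i bi) (B⊆A j bj)
    ; same⇒adj = λ i j bi bj → same⇒adj i j (B⊆A i bi) (B⊆A j bj) }
    where open Cluster cl

  classCount : VSet n → (Fin n → ℕ) → ℕ → ℕ
  classCount A lab r = count (λ i → A i ∧ (lab i ≡ᵇ r))

  -- In a cluster graph the class of w consists of w and its neighbours.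
  classCount-deg : ∀ {A a lab} w → Cluster A a lab → A w ≡ true → classCount A lab (lab w) ≡ suc (deg A w)
  classCount-deg {A} {a} {lab} w cl aw =
    trans (count-remove-member (λ i → A i ∧ (lab i ≡ᵇ lab w)) w (∧-true aw (≡ᵇ-complete {lab w} refl)))
          (cong suc (count-ext classmate))
    where
    open Cluster cl
    classmate : ∀ x → (A x ∧ (lab x ≡ᵇ lab w)) ∧ not (x == w) ≡ A x ∧ adj G w x
    classmate x = true-ext forward backward
      where
      forward : (A x ∧ (lab x ≡ᵇ lab w)) ∧ not (x == w) ≡ true → A x ∧ adj G w x ≡ true
      forward h = ∧-true ax (same⇒adj w x aw ax (λ e → x≢w (sym e)) (sym (≡ᵇ-sound (∧-trueʳ {A x} (∧-trueˡ h)))))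
        where
        ax : A x ≡ true
        ax = ∧-trueˡ (∧-trueˡ h)
        x≢w : x ≢ w
        x≢w refl = false≢true (not-true (∧-trueʳ {A x ∧ (lab x ≡ᵇ lab w)} h)) (==-refl x)
      backward : A x ∧ adj G w x ≡ true → (A x ∧ (lab x ≡ᵇ lab w)) ∧ not (x == w) ≡ true
      backward h = ∧-true (∧-true ax (≡ᵇ-complete (sym (adj⇒same w x aw ax w≢x (∧-trueʳ {A x} h)))))
                          (not-false (==-false (λ e → w≢x (sym e))))
        where
        ax : A x ≡ true
        ax = ∧-trueˡ h
        w≢x : w ≢ x
        w≢x refl = false≢true (adj-irrefl G w) (∧-trueʳ {A x} h)

  ∖N-cluster : ∀ {A a lab} v → Cluster A a lab → A v ≡ true → ∀ i → (A ∖N[ v ]) i ≡ A i ∧ not (lab i ≡ᵇ lab v)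
  ∖N-cluster {A} {a} {lab} v cl av i with A i in ai
  ... | false = refl
  ... | true with i ≟ v
  ...   | yes refl rewrite ==-refl i | ≡ᵇ-complete {lab i} refl = refl
  ...   | no i≢v rewrite ==-false i≢v with adj G v i in avi
  ...     | true  rewrite ≡ᵇ-complete (sym (Cluster.adj⇒same cl v i av ai (λ e → i≢v (sym e)) avi)) = refl
  ...     | false rewrite ≡ᵇ-false {lab i} {lab v} (λ e → false≢true avi (Cluster.same⇒adj cl v i av ai (λ e' → i≢v (sym e')) (sym e))) = refl

  classCount-∖ : ∀ A lab v → A v ≡ true → ∀ r → classCount A lab r ≡ ind (lab v ≡ᵇ r) + classCount (A ∖ v) lab r
  classCount-∖ A lab v av r =
    trans (count-remove (λ i → A i ∧ (lab i ≡ᵇ r)) v)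
          (cong₂ _+_ (cong (λ b → ind (b ∧ (lab v ≡ᵇ r))) av)
                     (count-ext (λ i → swap (A i) (lab i ≡ᵇ r) (not (i == v)))))
    where
    swap : ∀ a b c → (a ∧ b) ∧ c ≡ (a ∧ c) ∧ b
    swap a b c = trans (BoolP.∧-assoc a b c) (trans (cong (a ∧_) (BoolP.∧-comm b c)) (sym (BoolP.∧-assoc a c b)))

  classCount-∖N : ∀ {A a lab} v → Cluster A a lab → A v ≡ true → ∀ r →
    classCount (A ∖N[ v ]) lab r ≡ (if lab v ≡ᵇ r then 0 else classCount A lab r)
  classCount-∖N {A} {a} {lab} v cl av r with lab v ≡ᵇ r in e
  ... | true  = count-zero (λ i → trans (cong (_∧ (lab i ≡ᵇ r)) (∖N-cluster v cl av i)) (disjoint i))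
    where
    disjoint : ∀ i → (A i ∧ not (lab i ≡ᵇ lab v)) ∧ (lab i ≡ᵇ r) ≡ false
    disjoint i with lab i ≡ᵇ r in e'
    ... | false = BoolP.∧-zeroʳ _
    ... | true rewrite ≡ᵇ-complete {lab i} {lab v} (trans (≡ᵇ-sound e') (sym (≡ᵇ-sound e))) =
      cong (_∧ true) (BoolP.∧-zeroʳ (A i))
  ... | false = count-ext (λ i → trans (cong (_∧ (lab i ≡ᵇ r)) (∖N-cluster v cl av i)) (same i))
    where
    same : ∀ i → (A i ∧ not (lab i ≡ᵇ lab v)) ∧ (lab i ≡ᵇ r) ≡ A i ∧ (lab i ≡ᵇ r)
    same i with lab i ≡ᵇ r in e'
    ... | false = trans (BoolP.∧-zeroʳ _) (sym (BoolP.∧-zeroʳ (A i)))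
    ... | true rewrite ≡ᵇ-false {lab i} {lab v} (λ q → false≢true e (≡ᵇ-complete (trans (sym q) (≡ᵇ-sound e')))) =
      BoolP.∧-identityʳ _

  -- The Fibonacci index of a cluster graph: a choice of at most one vertex in
  -- each clique, i.e. the product over the classes of (size + 1).
  #stable-cluster : ∀ k A a lab → count A ≤ k → Cluster A a lab →
    #stable A ≡ prodRange a (λ r → suc (classCount A lab r))
  #stable-cluster k A a lab le cl with find A
  ... | inj₂ none = trans (#stable-empty A none)
      (sym (trans (prodRange-ext a (λ r _ → cong suc (count-zero (λ i → cong (_∧ _) (none i))))) (prodRange-1 a)))
  ... | inj₁ (v , av) with bound-suc A v av le
  ...   | k' , refl = begin
    #stable A                                        ≡⟨ #stable-deletion A v av ⟩
    #stable (A ∖ v) + #stable (A ∖N[ v ])            ≡⟨ cong₂ _+_ rest others ⟩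
    prodRange a H₁ + prodRange a H₂                  ≡⟨ cong₂ _+_ (prodRange-extract a H₁ r₀ r₀<a)
                                                                   (prodRange-extract a H₂ r₀ r₀<a) ⟩
    H₁ r₀ * R₁ + H₂ r₀ * R₂                          ≡⟨ cong₂ (λ x y → H₁ r₀ * x + y * R₂) R₁≡R H₂r₀≡1 ⟩
    H₁ r₀ * R + 1 * R₂                               ≡⟨ cong (λ x → H₁ r₀ * R + 1 * x) R₂≡R ⟩
    H₁ r₀ * R + 1 * R                                ≡⟨ sym (*-distribʳ-+ R (H₁ r₀) 1) ⟩
    (H₁ r₀ + 1) * R                                  ≡⟨ cong (_* R) (trans (+-comm (H₁ r₀) 1) (sym Hr₀)) ⟩
    H r₀ * R                                         ≡⟨ sym (prodRange-extract a H r₀ r₀<a) ⟩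
    prodRange a H ∎
    where
    open ≡-Reasoning
    r₀ : ℕ
    r₀ = lab v
    r₀<a : r₀ < a
    r₀<a = Cluster.label< cl v av
    H H₁ H₂ : ℕ → ℕ
    H  r = suc (classCount A lab r)
    H₁ r = suc (classCount (A ∖ v) lab r)
    H₂ r = suc (classCount (A ∖N[ v ]) lab r)
    R R₁ R₂ : ℕ
    R  = prodRange a (omit r₀ H)
    R₁ = prodRange a (omit r₀ H₁)
    R₂ = prodRange a (omit r₀ H₂)
    m≤k' : count (A ∖ v) ≤ k'
    m≤k' = s≤s⁻¹ (subst (_≤ suc k') (count-remove-member A v av) le)
    rest : #stable (A ∖ v) ≡ prodRange a H₁
    rest = #stable-cluster k' (A ∖ v) a lab m≤k' (Cluster-⊆ (∖-⊆ A v) cl)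
    others : #stable (A ∖N[ v ]) ≡ prodRange a H₂
    others = #stable-cluster k' (A ∖N[ v ]) a lab (≤-trans (count-mono (∖N-⊆∖ A v)) m≤k') (Cluster-⊆ (∖N-⊆ A v) cl)
    Hr₀ : H r₀ ≡ suc (H₁ r₀)
    Hr₀ = cong suc (trans (classCount-∖ A lab v av r₀) (cong (λ b → ind b + classCount (A ∖ v) lab r₀) (≡ᵇ-complete {r₀} refl)))
    H₂r₀≡1 : H₂ r₀ ≡ 1
    H₂r₀≡1 = cong suc (trans (classCount-∖N v cl av r₀) (cong (λ b → if b then 0 else classCount A lab r₀) (≡ᵇ-complete {r₀} refl)))
    R₁≡R : R₁ ≡ R
    R₁≡R = prodRange-omit-cong a r₀ λ r e → cong suc
      (sym (trans (classCount-∖ A lab v av r) (cong (λ b → ind b + classCount (A ∖ v) lab r) e)))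
    R₂≡R : R₂ ≡ R
    R₂≡R = prodRange-omit-cong a r₀ λ r e → cong suc
      (trans (classCount-∖N v cl av r) (cong (λ b → if b then 0 else classCount A lab r) e))

  record TuranShaped (A : VSet n) (a : ℕ) : Set where
    field
      lab     : Fin n → ℕ
      cluster : Cluster A a lab
      sizes   : ∀ r → r < a → classCount A lab r ≡ classSize (count A) a r

  -- If B is Turán-shaped with a classes and |B| = m − m/(a+1), every class of
  -- B has at least ⌊|B|/a⌋ ≥ m/(a+1) vertices, so 1 + deg w ≥ m/(a+1) in B.
  TuranShaped-deg : ∀ a m (B : VSet n) w → Bounded B a → TuranShaped B a →
    count B ≡ m ∸ m / suc a → B w ≡ true → m / suc a ≤ suc (deg B w)
  TuranShaped-deg zero    m B w bnd T cB bw = ⊥-elim (Bounded-0 w bw bnd)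
  TuranShaped-deg (suc b) m B w bnd T cB bw = begin
    m / suc (suc b)                    ≤⟨ quotient-shrink m b ⟩
    (m ∸ m / suc (suc b)) / suc b      ≡⟨ cong (_/ suc b) (sym cB) ⟩
    count B / suc b                    ≤⟨ classSize-≥ (count B) b (lab w) ⟩
    classSize (count B) (suc b) (lab w) ≡⟨ sym (sizes (lab w) (Cluster.label< cluster w bw)) ⟩
    classCount B lab (lab w)           ≡⟨ classCount-deg w cluster bw ⟩
    suc (deg B w) ∎
    where
    open ≤-Reasoning
    open TuranShaped T

  -- Equality in the bound on A ∖ N[v] forces deg v = m / (a + 1): turanF is
  -- strictly increasing when a ≥ 1, and for a = 0 the set A ∖ N[v] is empty.
  degree-exact : ∀ a (B : VSet n) m d → Bounded B a → count B ≡ m ∸ d → d ≤ m → m / suc a ≤ d →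
    turanF (count B) a ≡ turanF (m ∸ m / suc a) a → d ≡ m / suc a
  degree-exact zero B m d bnd cB d≤m _ _ =
    trans (≤-antisym d≤m (m∸n≡0⇒m≤n (trans (sym cB) (Bounded-0-empty bnd)))) (sym (n/1≡n m))
  degree-exact (suc b) B m d bnd cB d≤m q≤d same with d ≤? m / suc (suc b)
  ... | yes d≤q = ≤-antisym d≤q q≤d
  ... | no d≰q  = ⊥-elim (<-irrefl same (turanF-strict b
                    (subst (_< m ∸ m / suc (suc b)) (sym cB) (∸-monoʳ-< (≰⇒> d≰q) d≤m))))

  module ExtremalPivot {A a} (P : Pivot A) (bnd : Bounded A (suc a))
    (T₁ : TuranShaped (A ∖ Pivot.v P) (suc a)) (T₂ : TuranShaped (A ∖N[ Pivot.v P ]) a)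
    (deg≡q : deg A (Pivot.v P) ≡ count (A ∖ Pivot.v P) / suc a) where

    open Pivot P
    open PivotFacts P bnd
    open TuranShaped T₁ renaming (lab to lab₁; cluster to cluster₁; sizes to sizes₁)

    q : ℕ
    q = m / suc a

    count-∖N′ : count (A ∖N[ v ]) ≡ m ∸ q
    count-∖N′ = trans count-∖N (cong (m ∸_) deg≡q)

    record NeighbourClass : Set where
      field
        k      : ℕ
        k<     : k < suc a
        k-size : classSize m (suc a) k ≡ q
        adj⇒k  : ∀ w → (A ∖ v) w ≡ true → adj G v w ≡ true → lab₁ w ≡ k
        k⇒adj  : ∀ w → (A ∖ v) w ≡ true → lab₁ w ≡ k → adj G v w ≡ true

    -- If v has no neighbour then q = 0, and the empty class m mod (a+1) serves.
    isolated : (∀ u → A u ∧ adj G v u ≡ false) → NeighbourClass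
    isolated none = record
      { k = m % suc a ; k< = m%n<n m (suc a) ; k-size = classSize-remainder m a
      ; adj⇒k = λ w w∈ avw → ⊥-elim (false≢true (none w) (∧-true (∖-⊆ A v w w∈) avw))
      ; k⇒adj = λ w w∈ e → ⊥-elim (1+n≰n (≤-trans (count-member _ w (∧-true w∈ (≡ᵇ-complete e))) (≤-reflexive empty))) }
      where
      empty : classCount (A ∖ v) lab₁ (m % suc a) ≡ 0
      empty = trans (sizes₁ (m % suc a) (m%n<n m (suc a)))
                    (trans (classSize-remainder m a) (trans (sym deg≡q) (count-zero none)))

    -- Otherwise take the class of a neighbour u.
    module ViaNeighbour (u : Fin n) (u∈N : A u ∧ adj G v u ≡ true) where
      u∈A : A u ≡ true
      u∈A = ∧-trueˡ u∈N
      vu : adj G v u ≡ true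
      vu = ∧-trueʳ {A u} u∈N
      u∈A∖v : (A ∖ v) u ≡ true
      u∈A∖v = ∈∖-intro A v u u∈A (λ { refl → false≢true (adj-irrefl G u) vu })
      k : ℕ
      k = lab₁ u

      -- u's class has deg_A u ≤ deg v = q elements, and at least q as every class does.
      k-count : classCount (A ∖ v) lab₁ k ≡ q
      k-count = ≤-antisym (subst (_≤ q) (sym deg-u) (subst (deg A u ≤_) deg≡q (maximal u u∈A)))
                          (subst (q ≤_) (sym (sizes₁ k k<)) (classSize-≥ m a k))
        where
        k< : k < suc a
        k< = Cluster.label< cluster₁ u u∈A∖v
        deg-u : classCount (A ∖ v) lab₁ k ≡ deg A u
        deg-u = trans (classCount-deg u cluster₁ u∈A∖v) (sym (deg-∖ A v u v∈A (trans (adj-sym G u v) vu)))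

      -- A non-neighbour w in u's class would lie in A ∖ N[v] with fewer than
      -- q − 1 neighbours there, contradicting the class sizes of A ∖ N[v].
      class⇒adj : ∀ w → (A ∖ v) w ≡ true → lab₁ w ≡ k → adj G v w ≡ true
      class⇒adj w w∈ lw with adj G v w in vw
      ... | true  = refl
      ... | false = ⊥-elim (1+n≰n (≤-trans too-small
                      (TuranShaped-deg a m (A ∖N[ v ]) w (Bounded-∖N v v∈A bnd) T₂ count-∖N′ w∈N)))
        where
        w∈N : (A ∖N[ v ]) w ≡ true
        w∈N = ∈∖N-intro A v w (proj₁ (∈∖-elim A v w w∈)) (proj₂ (∈∖-elim A v w w∈)) vw
        u∉N : (A ∖N[ v ]) u ≡ false
        u∉N with (A ∖N[ v ]) u in e
        ... | false = refl
        ... | true  = ⊥-elim (false≢true (proj₂ (proj₂ (∈∖N-elim A v u e))) vu)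
        wu : adj G w u ≡ true
        wu = Cluster.same⇒adj cluster₁ w u w∈ u∈A∖v (λ { refl → false≢true vw vu }) lw
        fewer : deg (A ∖N[ v ]) w < deg (A ∖ v) w
        fewer = count-strict (λ i e → ∧-true (∖N-⊆∖ A v i (∧-trueˡ e)) (∧-trueʳ {(A ∖N[ v ]) i} e))
                             u (∧-true u∈A∖v wu) (cong (_∧ adj G w u) u∉N)
        w-class : suc (deg (A ∖ v) w) ≡ q
        w-class = trans (sym (classCount-deg w cluster₁ w∈)) (trans (cong (classCount (A ∖ v) lab₁) lw) k-count)
        too-small : suc (suc (deg (A ∖N[ v ]) w)) ≤ q
        too-small = subst (suc (suc (deg (A ∖N[ v ]) w)) ≤_) w-class (s≤s fewer)

      -- The class is contained in N(v) and has its size deg v, so it is N(v).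
      adj⇒class : ∀ w → (A ∖ v) w ≡ true → adj G v w ≡ true → lab₁ w ≡ k
      adj⇒class w w∈ vw = ≡ᵇ-sound (∧-trueʳ {(A ∖ v) w} (count-tight
        {P = λ i → (A ∖ v) i ∧ (lab₁ i ≡ᵇ k)} {Q = λ i → (A ∖ v) i ∧ adj G v i}
        (λ i e → ∧-true (∧-trueˡ e) (class⇒adj i (∧-trueˡ e) (≡ᵇ-sound (∧-trueʳ {(A ∖ v) i} e))))
        (trans k-count (trans (sym deg≡q) (sym (deg-∖-self A v)))) w (∧-true w∈ vw)))

      neighbourClass : NeighbourClass
      neighbourClass = record
        { k = k ; k< = Cluster.label< cluster₁ u u∈A∖v
        ; k-size = trans (sym (sizes₁ k (Cluster.label< cluster₁ u u∈A∖v))) k-count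
        ; adj⇒k = adj⇒class ; k⇒adj = class⇒adj }

    -- Put v into the neighbour class k and rename k to r = m mod (a+1), the
    -- class of T_{m+1,a+1} that is larger than in T_{m,a+1}; sizes then match.
    module Extension (N : NeighbourClass) where
      open NeighbourClass N
      r : ℕ
      r = m % suc a
      r< : r < suc a
      r< = m%n<n m (suc a)
      open Transposition k r

      lab : Fin n → ℕ
      lab i = if i == v then r else swap (lab₁ i)

      lab-v : lab v ≡ r
      lab-v rewrite ==-refl v = refl

      lab-other : ∀ i → i ≢ v → lab i ≡ swap (lab₁ i)
      lab-other i i≢v rewrite ==-false i≢v = refl

      ∈∖v : ∀ {i} → A i ≡ true → i ≢ v → (A ∖ v) i ≡ true
      ∈∖v {i} ai i≢v = ∈∖-intro A v i ai i≢v

      label< : ∀ i → A i ≡ true → lab i < suc a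
      label< i ai with i ≟ v
      ... | yes refl = subst (_< suc a) (sym lab-v) r<
      ... | no i≢v   = subst (_< suc a) (sym (lab-other i i≢v))
                             (swap-< k< r< (Cluster.label< cluster₁ i (∈∖v ai i≢v)))

      v-adj⇒same : ∀ j → A j ≡ true → j ≢ v → adj G v j ≡ true → lab v ≡ lab j
      v-adj⇒same j aj j≢v vj = trans lab-v (trans (sym swap-k)
        (trans (cong swap (sym (adj⇒k j (∈∖v aj j≢v) vj))) (sym (lab-other j j≢v))))

      v-same⇒adj : ∀ j → A j ≡ true → j ≢ v → lab v ≡ lab j → adj G v j ≡ true
      v-same⇒adj j aj j≢v e = k⇒adj j (∈∖v aj j≢v)
        (swap-injective (trans (sym (lab-other j j≢v)) (trans (sym e) (trans lab-v (sym swap-k)))))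

      adj⇒same : ∀ i j → A i ≡ true → A j ≡ true → i ≢ j → adj G i j ≡ true → lab i ≡ lab j
      adj⇒same i j ai aj i≢j ij with i ≟ v | j ≟ v
      ... | yes refl | yes refl = ⊥-elim (i≢j refl)
      ... | yes refl | no j≢v   = v-adj⇒same j aj j≢v ij
      ... | no i≢v   | yes refl = sym (v-adj⇒same i ai i≢v (trans (adj-sym G v i) ij))
      ... | no i≢v   | no j≢v   = trans (lab-other i i≢v) (trans (cong swap
          (Cluster.adj⇒same cluster₁ i j (∈∖v ai i≢v) (∈∖v aj j≢v) i≢j ij)) (sym (lab-other j j≢v)))

      same⇒adj : ∀ i j → A i ≡ true → A j ≡ true → i ≢ j → lab i ≡ lab j → adj G i j ≡ true
      same⇒adj i j ai aj i≢j e with i ≟ v | j ≟ v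
      ... | yes refl | yes refl = ⊥-elim (i≢j refl)
      ... | yes refl | no j≢v   = v-same⇒adj j aj j≢v e
      ... | no i≢v   | yes refl = trans (adj-sym G i v) (v-same⇒adj i ai i≢v (sym e))
      ... | no i≢v   | no j≢v   = Cluster.same⇒adj cluster₁ i j (∈∖v ai i≢v) (∈∖v aj j≢v) i≢j
          (swap-injective (trans (sym (lab-other i i≢v)) (trans e (lab-other j j≢v))))

      cluster : Cluster A (suc a) lab
      cluster = record { label< = label< ; adj⇒same = adj⇒same ; same⇒adj = same⇒adj }

      relabel : ∀ s i → (A i ∧ (lab i ≡ᵇ s)) ∧ not (i == v) ≡ (A ∖ v) i ∧ (lab₁ i ≡ᵇ swap s)
      relabel s i with i ≟ v
      ... | yes refl rewrite ==-refl i = trans (BoolP.∧-zeroʳ _) (cong (_∧ (lab₁ i ≡ᵇ swap s)) (sym (BoolP.∧-zeroʳ (A i))))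
      ... | no i≢v rewrite ==-false i≢v = trans (BoolP.∧-identityʳ _)
          (trans (cong (A i ∧_) (swap-≡ᵇ (lab₁ i) s)) (cong (_∧ (lab₁ i ≡ᵇ swap s)) (sym (BoolP.∧-identityʳ (A i)))))

      sizes : ∀ s → s < suc a → classCount A lab s ≡ classSize (count A) (suc a) s
      sizes s s< = begin
        classCount A lab s
          ≡⟨ count-remove (λ i → A i ∧ (lab i ≡ᵇ s)) v ⟩
        ind (A v ∧ (lab v ≡ᵇ s)) + count (λ i → (A i ∧ (lab i ≡ᵇ s)) ∧ not (i == v))
          ≡⟨ cong₂ _+_ (cong ind (trans (cong (_∧ (lab v ≡ᵇ s)) v∈A) (cong (_≡ᵇ s) lab-v))) (count-ext (relabel s)) ⟩
        ind (r ≡ᵇ s) + classCount (A ∖ v) lab₁ (swap s)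
          ≡⟨ cong (ind (r ≡ᵇ s) +_) (trans (sizes₁ (swap s) (swap-< k< r< s<))
                (swap-invariant (classSize m (suc a)) (trans k-size (sym (classSize-remainder m a))) s)) ⟩
        ind (r ≡ᵇ s) + classSize m (suc a) s
          ≡⟨ sym (classSize-suc m a s s<) ⟩
        classSize (suc m) (suc a) s
          ≡⟨ cong (λ z → classSize z (suc a) s) (sym count-A) ⟩
        classSize (count A) (suc a) s ∎
        where open ≡-Reasoning

      shaped : TuranShaped A (suc a)
      shaped = record { lab = lab ; cluster = cluster ; sizes = sizes }

    extremalPivot : TuranShaped A (suc a)
    extremalPivot with find (λ u → A u ∧ adj G v u)
    ... | inj₁ (u , u∈N) = Extension.shaped (ViaNeighbour.neighbourClass u u∈N)
    ... | inj₂ none      = Extension.shaped (isolated none)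

  TuranShaped-empty : ∀ A a → (∀ i → A i ≡ false) → TuranShaped A a
  TuranShaped-empty A a none = record
    { lab = λ _ → 0
    ; cluster = record { label< = λ i ai → ⊥-elim (false≢true (none i) ai)
                       ; adj⇒same = λ i _ ai → ⊥-elim (false≢true (none i) ai)
                       ; same⇒adj = λ i _ ai → ⊥-elim (false≢true (none i) ai) }
    ; sizes = λ r _ → trans (count-zero (λ i → cong (_∧ (0 ≡ᵇ r)) (none i)))
                            (sym (trans (cong (λ z → classSize z a r) (count-zero none)) (classSize-0 a r))) }

  -- At a pivot v both recursive estimates of the
  -- upper bound are tight; this pins down deg v and, by induction, makes
  -- A ∖ v and A ∖ N[v] Turán-shaped.
  extremal : ∀ k a A → count A ≤ k → Bounded A a → #stable A ≡ turanF (count A) a → TuranShaped A a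
  extremal k a A le bnd same with pivot A
  ... | inj₂ none = TuranShaped-empty A a none
  ... | inj₁ P with a
  ...   | zero  = ⊥-elim (Bounded-0 (Pivot.v P) (Pivot.v∈A P) bnd)
  ...   | suc a with bound-suc A (Pivot.v P) (Pivot.v∈A P) le
  ...     | k' , refl = ExtremalPivot.extremalPivot P bnd T₁ T₂ deg≡q
    where
    open Pivot P
    open PivotFacts P bnd
    m≤k' : m ≤ k'
    m≤k' = s≤s⁻¹ (subst (_≤ suc k') count-A le)
    bnd₁ : Bounded (A ∖ v) (suc a)
    bnd₁ = Bounded-⊆ (∖-⊆ A v) bnd
    bnd₂ : Bounded (A ∖N[ v ]) a
    bnd₂ = Bounded-∖N v v∈A bnd
    k′-bounds-∖N : count (A ∖N[ v ]) ≤ k'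
    k′-bounds-∖N = ≤-trans (count-mono (∖N-⊆∖ A v)) m≤k'
    rest : #stable (A ∖ v) ≤ turanF m (suc a)
    rest = upperBound k' (suc a) (A ∖ v) m≤k' bnd₁
    neighbours : #stable (A ∖N[ v ]) ≤ turanF (count (A ∖N[ v ])) a
    neighbours = upperBound k' a (A ∖N[ v ]) k′-bounds-∖N bnd₂
    total : #stable (A ∖ v) + #stable (A ∖N[ v ]) ≡ turanF m (suc a) + turanF (m ∸ m / suc a) a
    total = trans (sym (#stable-deletion A v v∈A))
                  (trans same (trans (cong (λ z → turanF z (suc a)) count-A) (turanF-step m a)))
    tight : #stable (A ∖ v) ≡ turanF m (suc a) × #stable (A ∖N[ v ]) ≡ turanF (m ∸ m / suc a) a
    tight = tight-split rest (≤-trans neighbours (turanF-mono a ∖N-small)) total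
    tight₂ : #stable (A ∖N[ v ]) ≡ turanF (count (A ∖N[ v ])) a
    tight₂ = ≤-antisym neighbours (subst (turanF (count (A ∖N[ v ])) a ≤_) (sym (proj₂ tight)) (turanF-mono a ∖N-small))
    deg≡q : deg A v ≡ m / suc a
    deg≡q = degree-exact a (A ∖N[ v ]) m (deg A v) bnd₂ count-∖N deg-≤ deg-≥ (trans (sym tight₂) (proj₂ tight))
    T₁ : TuranShaped (A ∖ v) (suc a)
    T₁ = extremal k' (suc a) (A ∖ v) m≤k' bnd₁ (proj₁ tight)
    T₂ : TuranShaped (A ∖N[ v ]) a
    T₂ = extremal k' a (A ∖N[ v ]) k′-bounds-∖N bnd₂ tight₂

-- An injective map Fin n → Fin n is surjective (otherwise it would inject
-- Fin n into Fin (n − 1)), hence a permutation.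
injective⇒surjective : ∀ {n} (h : Fin n → Fin n) → (∀ {x y} → h x ≡ h y → x ≡ y) →
  ∀ y → Σ (Fin n) λ x → h x ≡ y
injective⇒surjective {suc n} h inj y with find (λ x → h x == y)
... | inj₁ (x , e) = x , ==-sound e
... | inj₂ none    = ⊥-elim (1+n≰n (injective⇒≤ {f = h′} h′-injective))
  where
  missed : ∀ x → y ≢ h x
  missed x e = false≢true (none x) (trans (cong (h x ==_) e) (==-refl (h x)))
  h′ : Fin (suc n) → Fin n
  h′ x = punchOut (missed x)
  h′-injective : ∀ {x x'} → h′ x ≡ h′ x' → x ≡ x'
  h′-injective {x} {x'} e = inj (punchOut-injective (missed x) (missed x') e)

injective⇒permutation : ∀ {n} (h : Fin n → Fin n) → (∀ {x y} → h x ≡ h y → x ≡ y) →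
  Σ (Permutation′ n) λ π → ∀ i → π ⟨$⟩ʳ i ≡ h i
injective⇒permutation h inj =
  permutation h (λ y → proj₁ (onto y)) (λ y → proj₂ (onto y)) (λ x → inj (proj₂ (onto (h x)))) , λ _ → refl
  where
  onto : ∀ y → Σ (Fin _) λ x → h x ≡ y
  onto = injective⇒surjective h inj

module TuranLabelling (n a : ℕ) where

  α : ℕ
  α = suc a

  turanAdj-distinct : ∀ i j → i ≢ j → turanAdj n α i j ≡ (toℕ i % α ≡ᵇ toℕ j % α)
  turanAdj-distinct i j i≢j with i ≟ j
  ... | yes i≡j = ⊥-elim (i≢j i≡j)
  ... | no _    = isYes≗does (toℕ i % α ℕP.≟ toℕ j % α)

  labelling-cluster : ∀ (G : Graph n) (lab : Fin n → ℕ) → (∀ i → lab i < α) →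
    (∀ i j → i ≢ j → adj G i j ≡ (lab i ≡ᵇ lab j)) → StableSets.Cluster G everything α lab
  labelling-cluster G lab lab< adj≡ = record
    { label<   = λ i _ → lab< i
    ; adj⇒same = λ i j _ _ i≢j e → ≡ᵇ-sound (trans (sym (adj≡ i j i≢j)) e)
    ; same⇒adj = λ i j _ _ i≢j e → trans (adj≡ i j i≢j) (≡ᵇ-complete e) }

  ≃-TuranShaped : ∀ (G : Graph n) → G ≃G turan n α → StableSets.TuranShaped G everything α
  ≃-TuranShaped G (π , adj-π) = record { lab = lab ; cluster = cluster ; sizes = sizes }
    where
    lab : Fin n → ℕ
    lab i = toℕ (π ⟨$⟩ʳ i) % α
    π-injective : ∀ {i j} → i ≢ j → π ⟨$⟩ʳ i ≢ π ⟨$⟩ʳ j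
    π-injective {i} {j} i≢j e = i≢j (trans (sym (inverseˡ π)) (trans (cong (π ⟨$⟩ˡ_) e) (inverseˡ π)))
    cluster : StableSets.Cluster G everything α lab
    cluster = labelling-cluster G lab (λ i → m%n<n (toℕ (π ⟨$⟩ʳ i)) α)
      (λ i j i≢j → trans (adj-π i j) (turanAdj-distinct _ _ (π-injective i≢j)))
    sizes : ∀ r → r < α → count (λ i → true ∧ (lab i ≡ᵇ r)) ≡ classSize (count {n} everything) α r
    sizes r r< = trans (count-permute (λ y → toℕ y % α ≡ᵇ r) π)
                       (trans (classSize-residues n a r r<) (cong (λ z → classSize z α r) (sym (count-all n))))

  -- Conversely a Turán-shaped graph is isomorphic to turan n α: the vertex of
  -- rank k in class r (ordering each class as in Fin n) is sent to k·α + r.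
  TuranShaped-≃ : ∀ (G : Graph n) → StableSets.TuranShaped G everything α → G ≃G turan n α
  TuranShaped-≃ G shaped = π , adjacency
    where
    open StableSets.TuranShaped shaped
    open StableSets.Cluster cluster

    lab< : ∀ i → lab i < α
    lab< i = label< i refl

    classSizes : ∀ r → r < α → count (λ i → lab i ≡ᵇ r) ≡ classSize n α r
    classSizes r r< = trans (sizes r r<) (cong (λ z → classSize z α r) (count-all n))

    rank : Fin n → ℕ
    rank i = count (λ j → (toℕ j <ᵇ toℕ i) ∧ (lab j ≡ᵇ lab i))

    rank< : ∀ i → rank i < classSize n α (lab i)
    rank< i = subst (rank i <_) (classSizes (lab i) (lab< i))
      (count-strict (λ j e → ∧-trueʳ {toℕ j <ᵇ toℕ i} e) i (≡ᵇ-complete {lab i} refl)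
                    (cong (_∧ (lab i ≡ᵇ lab i)) (<ᵇ-irrefl (toℕ i))))

    rank-mono : ∀ i j → lab i ≡ lab j → toℕ i < toℕ j → rank i < rank j
    rank-mono i j li≡lj i<j = count-strict earlier i (∧-true (<ᵇ-complete i<j) (≡ᵇ-complete li≡lj))
                                           (cong (_∧ (lab i ≡ᵇ lab i)) (<ᵇ-irrefl (toℕ i)))
      where
      earlier : ∀ k → (toℕ k <ᵇ toℕ i) ∧ (lab k ≡ᵇ lab i) ≡ true → (toℕ k <ᵇ toℕ j) ∧ (lab k ≡ᵇ lab j) ≡ true
      earlier k e = ∧-true (<ᵇ-complete (<-trans (<ᵇ⇒< (toℕ k) (toℕ i) (subst T (sym (∧-trueˡ e)) _)) i<j))
                           (≡ᵇ-complete {lab k} (trans (≡ᵇ-sound (∧-trueʳ {toℕ k <ᵇ toℕ i} e)) li≡lj))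

    position : Fin n → Fin n
    position i = fromℕ< (classSize-slot n a (lab i) (rank i) (lab< i) (rank< i))

    position-toℕ : ∀ i → toℕ (position i) ≡ lab i + rank i * α
    position-toℕ i = trans (toℕ-fromℕ< _) (+-comm (rank i * α) (lab i))

    position-% : ∀ i → toℕ (position i) % α ≡ lab i
    position-% i = trans (cong (_% α) (position-toℕ i)) (divmod-% a (rank i) (lab i) (lab< i))

    position-/ : ∀ i → toℕ (position i) / α ≡ rank i
    position-/ i = trans (cong (_/ α) (position-toℕ i)) (divmod-/ a (rank i) (lab i) (lab< i))

    position-determines : ∀ {i j} → position i ≡ position j → lab i ≡ lab j × rank i ≡ rank j
    position-determines {i} {j} e =
      trans (sym (position-% i)) (trans (cong (λ z → toℕ z % α) e) (position-% j)) ,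
      trans (sym (position-/ i)) (trans (cong (λ z → toℕ z / α) e) (position-/ j))

    position-injective : ∀ {i j} → position i ≡ position j → i ≡ j
    position-injective {i} {j} e with <-cmp (toℕ i) (toℕ j) | position-determines e
    ... | tri≈ _ i≡j _ | _ = toℕ-injective i≡j
    ... | tri< i<j _ _ | same-lab , same-rank = ⊥-elim (<-irrefl same-rank (rank-mono i j same-lab i<j))
    ... | tri> _ _ j<i | same-lab , same-rank = ⊥-elim (<-irrefl (sym same-rank) (rank-mono j i (sym same-lab) j<i))

    π : Permutation′ n
    π = proj₁ (injective⇒permutation position position-injective)

    adjacency : ∀ i j → adj G i j ≡ adj (turan n α) (π ⟨$⟩ʳ i) (π ⟨$⟩ʳ j)
    adjacency i j rewrite proj₂ (injective⇒permutation position position-injective) i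
                        | proj₂ (injective⇒permutation position position-injective) j with i ≟ j
    ... | yes refl = trans (adj-irrefl G i) (sym (adj-irrefl (turan n α) (position i)))
    ... | no i≢j   = sym (begin
      turanAdj n α (position i) (position j)          ≡⟨ turanAdj-distinct _ _ (λ e → i≢j (position-injective e)) ⟩
      (toℕ (position i) % α ≡ᵇ toℕ (position j) % α) ≡⟨ cong₂ _≡ᵇ_ (position-% i) (position-% j) ⟩
      (lab i ≡ᵇ lab j)                                ≡⟨ true-ext (same⇒adj i j refl refl i≢j ∘ ≡ᵇ-sound)
                                                                  (≡ᵇ-complete ∘ adj⇒same i j refl refl i≢j) ⟩
      adj G i j ∎)
      where open ≡-Reasoning

  fibIndex-TuranShaped : ∀ (G : Graph n) → StableSets.TuranShaped G everything α → fibIndex G ≡ turanF n α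
  fibIndex-TuranShaped G shaped = begin
    fibIndex G                                               ≡⟨ fibIndex-#stable ⟩
    #stable everything                                       ≡⟨ #stable-cluster n everything α lab (≤-reflexive (count-all n)) cluster ⟩
    prodRange α (λ r → suc (classCount everything lab r))    ≡⟨ prodRange-ext α (λ r r< → cong suc (sizes r r<)) ⟩
    prodRange α (λ r → suc (classSize (count {n} everything) α r)) ≡⟨ prodRange-classSize (count {n} everything) α ⟩
    turanF (count {n} everything) α                          ≡⟨ cong (λ z → turanF z α) (count-all n) ⟩
    turanF n α ∎
    where
    open ≡-Reasoning
    open StableSets G
    open TuranShaped shaped

  fT≡turanF : fT n α ≡ turanF n α
  fT≡turanF = fibIndex-TuranShaped (turan n α) (≃-TuranShaped (turan n α) (Permutation.id , λ _ _ → refl))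

  fibIndex-≤ : ∀ (G : Graph n) → stabilityNumber G ≡ α → fibIndex G ≤ fT n α
  fibIndex-≤ G st = subst₂ _≤_ (sym fibIndex-#stable) (trans (cong (λ z → turanF z α) (count-all n)) (sym fT≡turanF))
    (upperBound n α everything (≤-reflexive (count-all n)) (stabilityNumber-Bounded α st))
    where open StableSets G

  fibIndex-≡⇒≃ : ∀ (G : Graph n) → stabilityNumber G ≡ α → fibIndex G ≡ fT n α → G ≃G turan n α
  fibIndex-≡⇒≃ G st e = TuranShaped-≃ G
    (extremal n α everything (≤-reflexive (count-all n)) (stabilityNumber-Bounded α st) #stable≡)
    where
    open StableSets G
    #stable≡ : #stable everything ≡ turanF (count {n} everything) α
    #stable≡ = trans (sym fibIndex-#stable) (trans e (trans fT≡turanF (cong (λ z → turanF z α) (sym (count-all n)))))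

  ≃⇒fibIndex-≡ : ∀ (G : Graph n) → G ≃G turan n α → fibIndex G ≡ fT n α
  ≃⇒fibIndex-≡ G iso = trans (fibIndex-TuranShaped G (≃-TuranShaped G iso)) (sym fT≡turanF)

theorem2 : (n α : ℕ) .{{_ : NonZero α}} (G : Graph n) → α ≤ n →
    stabilityNumber G ≡ α →
    (fibIndex G ≤ fT n α)
    × (fT n α ≡ (ceilDiv n α + 1) ^ (n % α) * (n / α + 1) ^ (α ∸ n % α))
    × ((fibIndex G ≡ fT n α) ⇔ (G ≃G turan n α))
theorem2 n (suc a) G _ st =
  fibIndex-≤ G st ,
  trans fT≡turanF (turanF-closedForm n a) ,
  mk⇔ (fibIndex-≡⇒≃ G st) (≃⇒fibIndex-≡ G)
  where open TuranLabelling n a
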